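{- Let $p$ be a prime greater than $2$, $m$ a positive integer, and $f \colon GF(p)^{2m} \to GF(p)$ a function of feasible Latin square type or of feasible negative Latin square type. Then for $1 \le i \le p$ and all $x \in GF(p)^{2m}$, the Fourier transform of $f_i^*$ satisfies \[ \widehat{f_i^*}(x) = N f_i(x) + N r_i\,\delta_0(x) - r_i. \]
   Context: Let $\zeta = e^{2\pi i/p}$, identify $GF(p)$ with $\{0,\dots,p-1\}$, $\langle\ ,\ \rangle$ the standard inner product; $W_f(x) = \sum_y \zeta^{f(y)-\langle x,y\rangle}$. The Fourier transform of $g\colon GF(p)^{2m}\to\mathbb{C}$ is $\hat g(x) = \sum_y g(y)\zeta^{ -\langle x,y\rangle}$. $\delta_0$ is the function equal to $1$ at $0$ and $0$ elsewhere. For $f$ even with $f(0)=0$: $D_i = f^{ -1}(i)$ for $1 \le i \le p-1$, $D_p = f^{ -1}(0)\setminus\{0\}$; $f_i$ is the indicator function of $D_i$; $\Gamma_i$ is the graph on $GF(p)^{2m}$ with distinct $x,y$ adjacent iff $x-y\in D_i$. A strongly regular graph with parameters $(\nu,k,\lambda,\mu)$ is $k$-regular on $\nu$ vertices, adjacent vertices having $\lambda$ and distinct nonadjacent vertices $\mu$ common neighbors. $f$ is of feasible Latin square type (resp. feasible negative Latin square type) if $f$ is even, $f(0)=0$, and each $\Gamma_i$ ($1\le i\le p$) is strongly regular with parameters $(N^2,(N-1)r_i, N+r_i^2-3r_i, r_i^2-r_i)$, where $N=p^m$ (resp. $N=-p^m$), $r_i = N/p$ for $1\le i\le p-1$, $r_p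 = N/p+1$. Such $f$ is bent with $W_f(x) = \zeta^{f^*(x)}p^m$ (Latin case) or $W_f(x) = -\zeta^{f^*(x)}p^m$ (negative Latin case) for a unique $f^*\colon GF(p)^{2m}\to GF(p)$, the dual of $f$. Set $D_i^* = (f^*)^{ -1}(i)$ for $1 \le i \le p-1$, $D_p^* = (f^*)^{ -1}(0)\setminus\{0\}$, and let $f_i^*$ be the indicator function of $D_i^*$. -}

module Defs where

open import Data.Bool using (Bool; true; false; _∧_; not; if_then_else_)
open import Data.Nat using (ℕ; zero; suc; NonZero; _∸_) renaming (_+_ to _+ℕ_; _*_ to _*ℕ_; _^_ to _^ℕ_)
import Data.Nat as ℕ
open import Data.Nat.DivMod using (_mod_)
open import Data.Fin using (Fin; toℕ)
import Data.Fin as Fin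
open import Data.Vec using (Vec; []; _∷_; replicate; zipWith; map)
open import Data.Vec.Properties using (≡-dec)
open import Data.List using (List; concatMap; allFin; foldr)
import Data.List as List
open import Data.Integer using (ℤ; +_; _+_; _*_; _-_; -_)
open import Data.Product using (Σ; _×_)
open import Relation.Binary.PropositionalEquality using (_≡_; _≢_)
open import Relation.Nullary.Decidable using (⌊_⌋)

module _ (p : ℕ) .{{_ : NonZero p}} where

  F : Set
  F = Fin p

  f0 : F
  f0 = 0 mod p

  fadd : F → F → F
  fadd a b = (toℕ a +ℕ toℕ b) mod p

  fmul : F → F → F
  fmul a b = (toℕ a *ℕ toℕ b) mod p

  fneg : F → F
  fneg a = (p ∸ toℕ a) mod p

  fsub : F → F → F
  fsub a b = fadd a (fneg b)

  Pt : ℕ → Set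
  Pt n = Vec F n

  vzero : ∀ {n} → Pt n
  vzero = replicate _ f0

  vneg : ∀ {n} → Pt n → Pt n
  vneg = map fneg

  vsub : ∀ {n} → Pt n → Pt n → Pt n
  vsub = zipWith fsub

  dot : ∀ {n} → Pt n → Pt n → F
  dot [] [] = f0
  dot (a ∷ u) (b ∷ v) = fadd (fmul a b) (dot u v)

  veq : ∀ {n} → Pt n → Pt n → Bool
  veq x y = ⌊ ≡-dec Fin._≟_ x y ⌋

  feq : F → F → Bool
  feq a b = ⌊ a Fin.≟ b ⌋

  allPts : (n : ℕ) → List (Pt n)
  allPts zero = [] List.∷ List.[]
  allPts (suc n) = concatMap (λ a → List.map (a ∷_) (allPts n)) (allFin p)

  -- Z[ζ], ζ = e^{2πi/p}: an element Σ_k c_k ζ^k is a coefficient vector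
  -- c : Fin p → ℤ; two vectors represent the same number iff they differ
  -- by a constant (since 1+ζ+…+ζ^{p-1} = 0 is the only relation, p prime).
  Cyc : Set
  Cyc = F → ℤ

  _≈_ : Cyc → Cyc → Set
  a ≈ b = Σ ℤ (λ c → ∀ k → a k ≡ b k + c)

  czero : Cyc
  czero _ = + 0

  cadd : Cyc → Cyc → Cyc
  cadd a b k = a k + b k

  mono : F → ℤ → Cyc
  mono j c k = if feq j k then c else + 0

  const : ℤ → Cyc
  const c = mono f0 c

  csum : List Cyc → Cyc
  csum = foldr cadd czero

  walsh : ∀ {n} → (Pt n → F) → Pt n → Cyc
  walsh {n} f x = csum (List.map (λ y → mono (fsub (f y) (dot x y)) (+ 1)) (allPts n))

  fourier : ∀ {n} → (Pt n → ℤ) → Pt n → Cyc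
  fourier {n} g x = csum (List.map (λ y → mono (fneg (dot x y)) (g y)) (allPts n))

  inD : ∀ {n} → (Pt n → F) → ℕ → Pt n → Bool
  inD f i x = if ⌊ i ℕ.≟ p ⌋ then (feq (f x) f0 ∧ not (veq x vzero))
                              else ⌊ toℕ (f x) ℕ.≟ i ⌋

  indic : ∀ {n} → (Pt n → F) → ℕ → Pt n → ℤ
  indic f i x = if inD f i x then + 1 else + 0

  adjΓ : ∀ {n} → (Pt n → F) → ℕ → Pt n → Pt n → Bool
  adjΓ f i x y = not (veq x y) ∧ inD f i (vsub x y)

count : ∀ {A : Set} → (A → Bool) → List A → ℕ
count P List.[] = 0
count P (a List.∷ as) = if P a then suc (count P as) else count P as

-- strongly regular graph with vertex list V (listing every vertex exactly once)
-- and adjacency relation adj, with parameters (ν,k,λ,μ)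
IsSRG : {A : Set} → List A → (A → A → Bool) → ℤ → ℤ → ℤ → ℤ → Set
IsSRG V adj ν k l μ =
  (+ List.length V ≡ ν)
  × (∀ x → + count (adj x) V ≡ k)
  × (∀ x y → adj x y ≡ true → + count (λ z → adj x z ∧ adj y z) V ≡ l)
  × (∀ x y → x ≢ y → adj x y ≡ false → + count (λ z → adj x z ∧ adj y z) V ≡ μ)

data LSType : Set where
  latin negLatin : LSType

sgn : LSType → ℤ
sgn latin = + 1
sgn negLatin = - (+ 1)

module _ (p : ℕ) .{{_ : NonZero p}} (m : ℕ) (s : LSType) where

  NN : ℤ
  NN = sgn s * + (p ^ℕ m)

  -- r_i = N/p for 1 ≤ i ≤ p-1, r_p = N/p + 1   (N/p = ± p^{m-1})
  rr : ℕ → ℤ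
  rr i = sgn s * + (p ^ℕ (m ∸ 1)) + (if ⌊ i ℕ.≟ p ⌋ then + 1 else + 0)

  IsFeasible : (Pt p (2 *ℕ m) → F p) → Set
  IsFeasible f =
    (∀ x → f (vneg p x) ≡ f x)
    × (f (vzero p) ≡ f0 p)
    × (∀ i → 1 ℕ.≤ i → i ℕ.≤ p →
         IsSRG (allPts p (2 *ℕ m)) (adjΓ p f i)
               (NN * NN) ((NN - + 1) * rr i)
               (NN + rr i * rr i - + 3 * rr i) (rr i * rr i - rr i))

  IsDual : (Pt p (2 *ℕ m) → F p) → (Pt p (2 *ℕ m) → F p) → Set
  IsDual f fs = ∀ x → _≈_ p (walsh p f x) (mono p (fs x) (sgn s * + (p ^ℕ m)))

module Submission where

-- Fix x ≠ 0 and, for j ∈ GF(p), let u_j = Σ_{f(y) = j} ζ^{-⟨x,y⟩} + N/p ∈ ℤ[ζ]. Counting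
-- common neighbours in the strongly regular graph Γ_i gives f̂ᵢ(x)² = (k - μ) + (λ - μ) f̂ᵢ(x),
-- and for the Latin square type parameters this says u_j² = N u_j, where u_j = f̂ᵢ(x) + r_i
-- for the i with D_i ⊆ f⁻¹(j). Moreover the u_j are real, Σ_j u_j = N, and, as Σ_j ζ^j = 0,
-- Σ_j ζ^j u_j = W_f(x) = N ζ^{f*(x)}. Positivity of the trace form then forces
-- u_j = N [j = f*(x)], that is f̂ᵢ(x) = N f*ᵢ(x) - r_i. Transforming these values of f̂ᵢ
-- back yields the Fourier transform of f*ᵢ.

open import Data.Bool using (Bool; true; false; if_then_else_; _∧_; not)
open import Data.Bool.Properties using (∧-zeroʳ; ∧-idem)
open import Data.Empty using (⊥-elim)
open import Data.Fin using (Fin; zero; suc; toℕ)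
import Data.Fin as Fin
import Data.Fin.Properties as FinP
open import Data.Integer using (ℤ; +_; -[1+_]; _+_; _*_; -_; _-_; _≤_; +≤+; ≢-nonZero)
  renaming (NonZero to NonZeroℤ)
open import Data.Integer.Properties
open import Data.Integer.Tactic.RingSolver using (solve-∀)
open import Data.List using (List; []; _∷_; map; concatMap; _++_; allFin; tabulate; length)
open import Data.List.Properties using (length-tabulate)
open import Data.Nat using (ℕ; zero; suc; NonZero; _∸_; z≤n)
  renaming (_+_ to _+ℕ_; _*_ to _*ℕ_; _^_ to _^ℕ_; _<_ to _<ℕ_; _≤_ to _≤ℕ_)
import Data.Nat as ℕ
import Data.Nat.Properties as ℕP
open import Data.Nat.DivMod
open import Data.Nat.Primality using (Prime; prime⇒nonZero; prime⇒nonTrivial)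
open import Data.Nat.Coprimality using (prime⇒coprime; coprime-Bézout)
import Data.Nat.GCD as GCD
open import Data.Product using (Σ; _,_; proj₁; proj₂; _×_)
open import Data.Sum using (reduce)
open import Data.Vec using ([]; _∷_)
import Data.Vec.Properties as VecP
open import Function using (case_of_)
open import Function.Bundles using (_⇔_; mk⇔)
open import Relation.Binary.Bundles using (Setoid)
open import Relation.Binary.Definitions using (DecidableEquality)
import Relation.Binary.Reasoning.Setoid
open import Relation.Binary.PropositionalEquality
open import Relation.Nullary using (¬_; Dec; yes; no)
open import Relation.Nullary.Decidable using (⌊_⌋; isYes≗does; dec-true; dec-false; does-⇔)

open import Defs hiding (_≈_)
import Defs

module _ {A : Set} where

  ⌊⌋-true : (a? : Dec A) → A → ⌊ a? ⌋ ≡ true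
  ⌊⌋-true a? a = trans (isYes≗does a?) (dec-true a? a)

  ⌊⌋-false : (a? : Dec A) → ¬ A → ⌊ a? ⌋ ≡ false
  ⌊⌋-false a? ¬a = trans (isYes≗does a?) (dec-false a? ¬a)

  ⌊⌋-⇔ : {B : Set} → A ⇔ B → (a? : Dec A) (b? : Dec B) → ⌊ a? ⌋ ≡ ⌊ b? ⌋
  ⌊⌋-⇔ A⇔B a? b? = trans (isYes≗does a?) (trans (does-⇔ A⇔B a? b?) (sym (isYes≗does b?)))

⌊≟⌋-sym : {A : Set} (_≟_ : DecidableEquality A) (a b : A) → ⌊ a ≟ b ⌋ ≡ ⌊ b ≟ a ⌋
⌊≟⌋-sym _≟_ a b = ⌊⌋-⇔ (mk⇔ sym sym) (a ≟ b) (b ≟ a)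

χ : Bool → ℤ
χ b = if b then + 1 else + 0

χ-∧ : ∀ a b → χ (a ∧ b) ≡ χ a * χ b
χ-∧ true b = sym (*-identityˡ (χ b))
χ-∧ false b = refl

χ-not-∧ : ∀ a b → χ (not (a ∧ b)) ≡ + 1 - χ a * χ b
χ-not-∧ true true = refl
χ-not-∧ true false = refl
χ-not-∧ false b = refl

∑ : {A : Set} → List A → (A → ℤ) → ℤ
∑ [] g = + 0
∑ (a ∷ L) g = g a + ∑ L g

module _ {A : Set} where

  ∑-cong : (L : List A) {g h : A → ℤ} → (∀ a → g a ≡ h a) → ∑ L g ≡ ∑ L h
  ∑-cong [] e = refl
  ∑-cong (a ∷ L) e = cong₂ _+_ (e a) (∑-cong L e)

  ∑-distrib-+ : (L : List A) (g h : A → ℤ) → ∑ L (λ a → g a + h a) ≡ ∑ L g + ∑ L h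
  ∑-distrib-+ [] g h = refl
  ∑-distrib-+ (a ∷ L) g h rewrite ∑-distrib-+ L g h = +-interchange (g a) (h a) (∑ L g) (∑ L h)
    where +-interchange : ∀ w x y z → w + x + (y + z) ≡ w + y + (x + z)
          +-interchange = solve-∀

  ∑-*ˡ : (L : List A) (c : ℤ) (g : A → ℤ) → ∑ L (λ a → c * g a) ≡ c * ∑ L g
  ∑-*ˡ [] c g = sym (*-zeroʳ c)
  ∑-*ˡ (a ∷ L) c g rewrite ∑-*ˡ L c g = sym (*-distribˡ-+ c (g a) (∑ L g))

  ∑-*ʳ : (L : List A) (c : ℤ) (g : A → ℤ) → ∑ L (λ a → g a * c) ≡ ∑ L g * c
  ∑-*ʳ L c g = trans (∑-cong L (λ a → *-comm (g a) c)) (trans (∑-*ˡ L c g) (*-comm c _))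

  ∑-zero : (L : List A) → ∑ L (λ _ → + 0) ≡ + 0
  ∑-zero [] = refl
  ∑-zero (a ∷ L) = trans (+-identityˡ _) (∑-zero L)

  ∑-const : (L : List A) (c : ℤ) → ∑ L (λ _ → c) ≡ + length L * c
  ∑-const [] c = sym (*-zeroˡ c)
  ∑-const (a ∷ L) c rewrite ∑-const L c = sym (suc-* (+ length L) c)

  ∑-neg : (L : List A) (g : A → ℤ) → ∑ L (λ a → - g a) ≡ - ∑ L g
  ∑-neg [] g = refl
  ∑-neg (a ∷ L) g rewrite ∑-neg L g = sym (neg-distrib-+ (g a) (∑ L g))

  ∑-distrib-- : (L : List A) (g h : A → ℤ) → ∑ L (λ a → g a - h a) ≡ ∑ L g - ∑ L h
  ∑-distrib-- L g h = trans (∑-distrib-+ L g (λ a → - h a)) (cong (_+_ (∑ L g)) (∑-neg L h))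

  ∑-mono-≤ : (L : List A) {g h : A → ℤ} → (∀ a → g a ≤ h a) → ∑ L g ≤ ∑ L h
  ∑-mono-≤ [] g≤h = ≤-refl
  ∑-mono-≤ (a ∷ L) g≤h = +-mono-≤ (g≤h a) (∑-mono-≤ L g≤h)

  ∑-nonneg : (L : List A) {g : A → ℤ} → (∀ a → + 0 ≤ g a) → + 0 ≤ ∑ L g
  ∑-nonneg L 0≤g = ≤-trans (≤-reflexive (sym (∑-zero L))) (∑-mono-≤ L 0≤g)

  ∑-++ : (L M : List A) (g : A → ℤ) → ∑ (L ++ M) g ≡ ∑ L g + ∑ M g
  ∑-++ [] M g = sym (+-identityˡ _)
  ∑-++ (a ∷ L) M g rewrite ∑-++ L M g = sym (+-assoc (g a) _ _)

module _ {A B : Set} where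

  ∑-comm : (L : List A) (M : List B) (g : A → B → ℤ) →
           ∑ L (λ a → ∑ M (λ b → g a b)) ≡ ∑ M (λ b → ∑ L (λ a → g a b))
  ∑-comm [] M g = sym (∑-zero M)
  ∑-comm (a ∷ L) M g rewrite ∑-comm L M g = sym (∑-distrib-+ M (g a) (λ b → ∑ L (λ a → g a b)))

  ∑-map : (L : List A) (h : A → B) (g : B → ℤ) → ∑ (map h L) g ≡ ∑ L (λ a → g (h a))
  ∑-map [] h g = refl
  ∑-map (a ∷ L) h g = cong (_+_ (g (h a))) (∑-map L h g)

  ∑-concatMap : (L : List A) (h : A → List B) (g : B → ℤ) →
                ∑ (concatMap h L) g ≡ ∑ L (λ a → ∑ (h a) g)
  ∑-concatMap [] h g = refl
  ∑-concatMap (a ∷ L) h g = trans (∑-++ (h a) (concatMap h L) g) (cong (_+_ (∑ (h a) g)) (∑-concatMap L h g))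

∑-tabulate : ∀ {A : Set} n (f : Fin n → A) (g : A → ℤ) → ∑ (tabulate f) g ≡ ∑ (allFin n) (λ a → g (f a))
∑-tabulate zero f g = refl
∑-tabulate (suc n) f g =
  cong (_+_ (g (f zero))) (trans (∑-tabulate n (λ a → f (suc a)) g) (sym (∑-tabulate n suc (λ a → g (f a)))))

count≡∑χ : ∀ {A : Set} (Q : A → Bool) (L : List A) → + count Q L ≡ ∑ L (λ z → χ (Q z))
count≡∑χ Q [] = refl
count≡∑χ Q (a ∷ L) with Q a
... | true = trans (pos-+ 1 (count Q L)) (cong (_+_ (+ 1)) (count≡∑χ Q L))
... | false = trans (count≡∑χ Q L) (sym (+-identityˡ _))

IsEnumeration : {A : Set} → DecidableEquality A → List A → Set
IsEnumeration _≟_ L = ∀ b → ∑ L (λ a → χ ⌊ a ≟ b ⌋) ≡ + 1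

module Enumeration {A : Set} (_≟_ : DecidableEquality A) (L : List A) (enum : IsEnumeration _≟_ L) where

  open ≡-Reasoning

  ∑-δ : (b : A) (g : A → ℤ) → ∑ L (λ a → χ ⌊ a ≟ b ⌋ * g a) ≡ g b
  ∑-δ b g = begin
    ∑ L (λ a → χ ⌊ a ≟ b ⌋ * g a) ≡⟨ ∑-cong L δ-g ⟩
    ∑ L (λ a → χ ⌊ a ≟ b ⌋ * g b) ≡⟨ ∑-*ʳ L (g b) _ ⟩
    ∑ L (λ a → χ ⌊ a ≟ b ⌋) * g b ≡⟨ cong (_* g b) (enum b) ⟩
    + 1 * g b                     ≡⟨ *-identityˡ (g b) ⟩
    g b ∎
    where
    δ-g : ∀ a → χ ⌊ a ≟ b ⌋ * g a ≡ χ ⌊ a ≟ b ⌋ * g b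
    δ-g a with a ≟ b
    ... | yes refl = refl
    ... | no _ = trans (*-zeroˡ (g a)) (sym (*-zeroˡ (g b)))

  ∑-δ′ : (b : A) (g : A → ℤ) → ∑ L (λ a → χ ⌊ b ≟ a ⌋ * g a) ≡ g b
  ∑-δ′ b g = trans (∑-cong L (λ a → cong (λ z → χ z * g a) (⌊≟⌋-sym _≟_ b a))) (∑-δ b g)

  ∑-reindex : (φ ψ : A → A) → (∀ a → ψ (φ a) ≡ a) → (∀ b → φ (ψ b) ≡ b) →
              (g : A → ℤ) → ∑ L (λ a → g (φ a)) ≡ ∑ L g
  ∑-reindex φ ψ ψφ φψ g = begin
    ∑ L (λ a → g (φ a))                               ≡⟨ ∑-cong L (λ a → sym (∑-δ (φ a) g)) ⟩
    ∑ L (λ a → ∑ L (λ b → χ ⌊ b ≟ φ a ⌋ * g b))       ≡⟨ ∑-comm L L _ ⟩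
    ∑ L (λ b → ∑ L (λ a → χ ⌊ b ≟ φ a ⌋ * g b))
      ≡⟨ ∑-cong L (λ b → ∑-cong L (λ a → cong (λ z → χ z * g b) (swap a b))) ⟩
    ∑ L (λ b → ∑ L (λ a → χ ⌊ a ≟ ψ b ⌋ * g b))
      ≡⟨ ∑-cong L (λ b → trans (∑-*ʳ L (g b) _) (cong (_* g b) (enum (ψ b)))) ⟩
    ∑ L (λ b → + 1 * g b)                             ≡⟨ ∑-cong L (λ b → *-identityˡ (g b)) ⟩
    ∑ L g ∎
    where
    swap : ∀ a b → ⌊ b ≟ φ a ⌋ ≡ ⌊ a ≟ ψ b ⌋
    swap a b = ⌊⌋-⇔ (mk⇔ (λ e → trans (sym (ψφ a)) (cong ψ (sym e))) (λ e → trans (sym (φψ b)) (cong φ (sym e))))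
                    (b ≟ φ a) (a ≟ ψ b)

  nonneg-∑≡0⇒≡0 : (g : A → ℤ) → (∀ a → + 0 ≤ g a) → ∑ L g ≡ + 0 → ∀ b → g b ≡ + 0
  nonneg-∑≡0⇒≡0 g 0≤g ∑g≡0 b = ≤-antisym gb≤0 (0≤g b)
    where
    δ≤ : ∀ a → χ ⌊ a ≟ b ⌋ * g a ≤ g a
    δ≤ a with a ≟ b
    ... | yes _ = ≤-reflexive (*-identityˡ (g a))
    ... | no _ = ≤-trans (≤-reflexive (*-zeroˡ (g a))) (0≤g a)
    gb≤0 : g b ≤ + 0
    gb≤0 = ≤-trans (≤-reflexive (sym (∑-δ b g))) (≤-trans (∑-mono-≤ L δ≤) (≤-reflexive ∑g≡0))

-- a ⊕ b is ι (toℕ a + toℕ b) by definition, so the ring laws of GF(p) are transported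
-- from ℕ along reduction mod p, ι, which is a surjective homomorphism.
module GF (p : ℕ) {{_ : NonZero p}} where

  open ≡-Reasoning

  infixl 6 _⊕_ _⊝_
  infixl 7 _⊗_

  ι : ℕ → F p
  ι n = n mod p

  _⊕_ _⊗_ _⊝_ : F p → F p → F p
  _⊕_ = fadd p
  _⊗_ = fmul p
  _⊝_ = fsub p

  ⊖ : F p → F p
  ⊖ = fneg p

  𝟘 : F p
  𝟘 = f0 p

  toℕ-ι : ∀ n → toℕ (ι n) ≡ n % p
  toℕ-ι n = FinP.toℕ-fromℕ< (m%n<n n p)

  ι-cong : ∀ {m n} → m % p ≡ n % p → ι m ≡ ι n
  ι-cong e = FinP.toℕ-injective (trans (toℕ-ι _) (trans e (sym (toℕ-ι _))))

  ι-toℕ : ∀ a → ι (toℕ a) ≡ a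
  ι-toℕ a = FinP.toℕ-injective (trans (toℕ-ι (toℕ a)) (m<n⇒m%n≡m (FinP.toℕ<n a)))

  ι-< : ∀ {n} → n <ℕ p → toℕ (ι n) ≡ n
  ι-< n<p = trans (toℕ-ι _) (m<n⇒m%n≡m n<p)

  toℕ-𝟘 : toℕ 𝟘 ≡ 0
  toℕ-𝟘 = ι-< (ℕ.>-nonZero⁻¹ p)

  ι-p : ι p ≡ 𝟘
  ι-p = ι-cong (trans (n%n≡0 p) (sym (m<n⇒m%n≡m (ℕ.>-nonZero⁻¹ p))))

  ι-+ : ∀ m n → ι (m +ℕ n) ≡ ι m ⊕ ι n
  ι-+ m n = ι-cong (begin
    (m +ℕ n) % p                         ≡⟨ %-distribˡ-+ m n p ⟩
    (m % p +ℕ n % p) % p                 ≡⟨ cong₂ (λ a b → (a +ℕ b) % p) (toℕ-ι m) (toℕ-ι n) ⟨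
    (toℕ (ι m) +ℕ toℕ (ι n)) % p ∎)

  ι-* : ∀ m n → ι (m *ℕ n) ≡ ι m ⊗ ι n
  ι-* m n = ι-cong (begin
    (m *ℕ n) % p                         ≡⟨ %-distribˡ-* m n p ⟩
    (m % p *ℕ (n % p)) % p               ≡⟨ cong₂ (λ a b → (a *ℕ b) % p) (toℕ-ι m) (toℕ-ι n) ⟨
    (toℕ (ι m) *ℕ toℕ (ι n)) % p ∎)

  ⊕-comm : ∀ a b → a ⊕ b ≡ b ⊕ a
  ⊕-comm a b = cong ι (ℕP.+-comm (toℕ a) (toℕ b))

  ⊗-comm : ∀ a b → a ⊗ b ≡ b ⊗ a
  ⊗-comm a b = cong ι (ℕP.*-comm (toℕ a) (toℕ b))

  ⊕-assoc : ∀ a b c → a ⊕ b ⊕ c ≡ a ⊕ (b ⊕ c)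
  ⊕-assoc a b c = begin
    a ⊕ b ⊕ c                           ≡⟨ cong (λ z → a ⊕ b ⊕ z) (ι-toℕ c) ⟨
    ι (toℕ a +ℕ toℕ b) ⊕ ι (toℕ c)      ≡⟨ ι-+ _ (toℕ c) ⟨
    ι (toℕ a +ℕ toℕ b +ℕ toℕ c)         ≡⟨ cong ι (ℕP.+-assoc (toℕ a) (toℕ b) (toℕ c)) ⟩
    ι (toℕ a +ℕ (toℕ b +ℕ toℕ c))       ≡⟨ ι-+ (toℕ a) _ ⟩
    ι (toℕ a) ⊕ (b ⊕ c)                 ≡⟨ cong (_⊕ (b ⊕ c)) (ι-toℕ a) ⟩
    a ⊕ (b ⊕ c) ∎

  ⊗-assoc : ∀ a b c → a ⊗ b ⊗ c ≡ a ⊗ (b ⊗ c)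
  ⊗-assoc a b c = begin
    a ⊗ b ⊗ c                           ≡⟨ cong (λ z → a ⊗ b ⊗ z) (ι-toℕ c) ⟨
    ι (toℕ a *ℕ toℕ b) ⊗ ι (toℕ c)      ≡⟨ ι-* _ (toℕ c) ⟨
    ι (toℕ a *ℕ toℕ b *ℕ toℕ c)         ≡⟨ cong ι (ℕP.*-assoc (toℕ a) (toℕ b) (toℕ c)) ⟩
    ι (toℕ a *ℕ (toℕ b *ℕ toℕ c))       ≡⟨ ι-* (toℕ a) _ ⟩
    ι (toℕ a) ⊗ (b ⊗ c)                 ≡⟨ cong (_⊗ (b ⊗ c)) (ι-toℕ a) ⟩
    a ⊗ (b ⊗ c) ∎

  ⊗-distribˡ-⊕ : ∀ a b c → a ⊗ (b ⊕ c) ≡ a ⊗ b ⊕ a ⊗ c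
  ⊗-distribˡ-⊕ a b c = begin
    a ⊗ (b ⊕ c)                               ≡⟨ cong (_⊗ (b ⊕ c)) (ι-toℕ a) ⟨
    ι (toℕ a) ⊗ ι (toℕ b +ℕ toℕ c)            ≡⟨ ι-* (toℕ a) _ ⟨
    ι (toℕ a *ℕ (toℕ b +ℕ toℕ c))             ≡⟨ cong ι (ℕP.*-distribˡ-+ (toℕ a) (toℕ b) (toℕ c)) ⟩
    ι (toℕ a *ℕ toℕ b +ℕ toℕ a *ℕ toℕ c)      ≡⟨ ι-+ _ _ ⟩
    a ⊗ b ⊕ a ⊗ c ∎

  ⊗-distribʳ-⊕ : ∀ a b c → (b ⊕ c) ⊗ a ≡ b ⊗ a ⊕ c ⊗ a
  ⊗-distribʳ-⊕ a b c = trans (⊗-comm _ a) (trans (⊗-distribˡ-⊕ a b c) (cong₂ _⊕_ (⊗-comm a b) (⊗-comm a c)))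

  ⊕-identityˡ : ∀ a → 𝟘 ⊕ a ≡ a
  ⊕-identityˡ a = trans (cong (λ z → ι (z +ℕ toℕ a)) toℕ-𝟘) (ι-toℕ a)

  ⊕-identityʳ : ∀ a → a ⊕ 𝟘 ≡ a
  ⊕-identityʳ a = trans (⊕-comm a 𝟘) (⊕-identityˡ a)

  ⊕-inverseʳ : ∀ a → a ⊕ ⊖ a ≡ 𝟘
  ⊕-inverseʳ a = begin
    a ⊕ ⊖ a                          ≡⟨ cong (_⊕ ⊖ a) (ι-toℕ a) ⟨
    ι (toℕ a) ⊕ ι (p ∸ toℕ a)        ≡⟨ ι-+ (toℕ a) _ ⟨
    ι (toℕ a +ℕ (p ∸ toℕ a))         ≡⟨ cong ι (ℕP.m+[n∸m]≡n (ℕP.<⇒≤ (FinP.toℕ<n a))) ⟩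
    ι p                              ≡⟨ ι-p ⟩
    𝟘 ∎

  ⊕-inverseˡ : ∀ a → ⊖ a ⊕ a ≡ 𝟘
  ⊕-inverseˡ a = trans (⊕-comm _ a) (⊕-inverseʳ a)

  ⊖-unique : ∀ a x → a ⊕ x ≡ 𝟘 → x ≡ ⊖ a
  ⊖-unique a x a+x≡0 = begin
    x                  ≡⟨ ⊕-identityʳ x ⟨
    x ⊕ 𝟘              ≡⟨ cong (x ⊕_) (⊕-inverseʳ a) ⟨
    x ⊕ (a ⊕ ⊖ a)      ≡⟨ ⊕-assoc x a (⊖ a) ⟨
    x ⊕ a ⊕ ⊖ a        ≡⟨ cong (_⊕ ⊖ a) (trans (⊕-comm x a) a+x≡0) ⟩
    𝟘 ⊕ ⊖ a            ≡⟨ ⊕-identityˡ _ ⟩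
    ⊖ a ∎

  ⊖-involutive : ∀ a → ⊖ (⊖ a) ≡ a
  ⊖-involutive a = sym (⊖-unique (⊖ a) a (⊕-inverseˡ a))

  ⊖-𝟘 : ⊖ 𝟘 ≡ 𝟘
  ⊖-𝟘 = sym (⊖-unique 𝟘 𝟘 (⊕-identityˡ 𝟘))

  ⊕-interchange : ∀ a b c d → (a ⊕ b) ⊕ (c ⊕ d) ≡ (a ⊕ c) ⊕ (b ⊕ d)
  ⊕-interchange a b c d = begin
    (a ⊕ b) ⊕ (c ⊕ d)    ≡⟨ ⊕-assoc a b _ ⟩
    a ⊕ (b ⊕ (c ⊕ d))    ≡⟨ cong (a ⊕_) (⊕-assoc b c d) ⟨
    a ⊕ (b ⊕ c ⊕ d)      ≡⟨ cong (λ z → a ⊕ (z ⊕ d)) (⊕-comm b c) ⟩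
    a ⊕ (c ⊕ b ⊕ d)      ≡⟨ cong (a ⊕_) (⊕-assoc c b d) ⟩
    a ⊕ (c ⊕ (b ⊕ d))    ≡⟨ ⊕-assoc a c _ ⟨
    (a ⊕ c) ⊕ (b ⊕ d) ∎

  ⊖-distrib-⊕ : ∀ a b → ⊖ (a ⊕ b) ≡ ⊖ a ⊕ ⊖ b
  ⊖-distrib-⊕ a b = sym (⊖-unique (a ⊕ b) (⊖ a ⊕ ⊖ b) (begin
    (a ⊕ b) ⊕ (⊖ a ⊕ ⊖ b)    ≡⟨ ⊕-interchange a b (⊖ a) (⊖ b) ⟩
    (a ⊕ ⊖ a) ⊕ (b ⊕ ⊖ b)    ≡⟨ cong₂ _⊕_ (⊕-inverseʳ a) (⊕-inverseʳ b) ⟩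
    𝟘 ⊕ 𝟘                    ≡⟨ ⊕-identityˡ 𝟘 ⟩
    𝟘 ∎))

  ⊗-zeroʳ : ∀ a → a ⊗ 𝟘 ≡ 𝟘
  ⊗-zeroʳ a = ι-cong (trans (cong (λ z → (toℕ a *ℕ z) % p) toℕ-𝟘) (cong (_% p) (ℕP.*-zeroʳ (toℕ a))))

  ⊗-zeroˡ : ∀ a → 𝟘 ⊗ a ≡ 𝟘
  ⊗-zeroˡ a = trans (⊗-comm 𝟘 a) (⊗-zeroʳ a)

  ⊗-⊖ʳ : ∀ a b → a ⊗ ⊖ b ≡ ⊖ (a ⊗ b)
  ⊗-⊖ʳ a b = ⊖-unique (a ⊗ b) (a ⊗ ⊖ b)
    (trans (sym (⊗-distribˡ-⊕ a b (⊖ b))) (trans (cong (a ⊗_) (⊕-inverseʳ b)) (⊗-zeroʳ a)))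

  ⊝-cancelˡ : ∀ k i → k ⊝ (k ⊝ i) ≡ i
  ⊝-cancelˡ k i = begin
    k ⊕ ⊖ (k ⊕ ⊖ i)        ≡⟨ cong (k ⊕_) (⊖-distrib-⊕ k (⊖ i)) ⟩
    k ⊕ (⊖ k ⊕ ⊖ (⊖ i))    ≡⟨ ⊕-assoc k (⊖ k) _ ⟨
    k ⊕ ⊖ k ⊕ ⊖ (⊖ i)      ≡⟨ cong₂ _⊕_ (⊕-inverseʳ k) (⊖-involutive i) ⟩
    𝟘 ⊕ i                  ≡⟨ ⊕-identityˡ i ⟩
    i ∎

  ⊕-⊝-cancel : ∀ l j → l ⊕ j ⊝ j ≡ l
  ⊕-⊝-cancel l j = trans (⊕-assoc l j (⊖ j)) (trans (cong (l ⊕_) (⊕-inverseʳ j)) (⊕-identityʳ l))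

  ⊝-⊕-cancel : ∀ l j → l ⊝ j ⊕ j ≡ l
  ⊝-⊕-cancel l j = trans (⊕-assoc l (⊖ j) j) (trans (cong (l ⊕_) (⊕-inverseˡ j)) (⊕-identityʳ l))

  ⊝-⊕ : ∀ k l j → k ⊝ (l ⊕ j) ≡ k ⊝ j ⊝ l
  ⊝-⊕ k l j = begin
    k ⊕ ⊖ (l ⊕ j)     ≡⟨ cong (k ⊕_) (trans (⊖-distrib-⊕ l j) (⊕-comm (⊖ l) (⊖ j))) ⟩
    k ⊕ (⊖ j ⊕ ⊖ l)   ≡⟨ ⊕-assoc k _ _ ⟨
    k ⊕ ⊖ j ⊕ ⊖ l ∎

  ⊝-𝟘 : ∀ k → k ⊝ 𝟘 ≡ k
  ⊝-𝟘 k = trans (cong (k ⊕_) ⊖-𝟘) (⊕-identityʳ k)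

  ≢𝟘⇒toℕ≢0 : ∀ {a} → a ≢ 𝟘 → toℕ a ≢ 0
  ≢𝟘⇒toℕ≢0 a≢0 e = a≢0 (FinP.toℕ-injective (trans e (sym toℕ-𝟘)))

  -- The index i ∈ [1, p] of the set D_i on which f takes the value j (D_p for j = 𝟘).
  index : F p → ℕ
  index j with j Fin.≟ 𝟘
  ... | yes _ = p
  ... | no _ = toℕ j

  index-range : ∀ j → 1 ≤ℕ index j × index j ≤ℕ p
  index-range j with j Fin.≟ 𝟘
  ... | yes _ = ℕ.>-nonZero⁻¹ p , ℕP.≤-refl
  ... | no j≢0 = ℕP.n≢0⇒n>0 (≢𝟘⇒toℕ≢0 j≢0) , ℕP.<⇒≤ (FinP.toℕ<n j)

  ι-index : ∀ j → ι (index j) ≡ j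
  ι-index j with j Fin.≟ 𝟘
  ... | yes j≡0 = trans ι-p (sym j≡0)
  ... | no _ = ι-toℕ j

  index≡p : ∀ j → ⌊ index j ℕ.≟ p ⌋ ≡ feq p 𝟘 j
  index≡p j with j Fin.≟ 𝟘
  ... | yes j≡0 = trans (⌊⌋-true (p ℕ.≟ p) refl) (sym (⌊⌋-true (𝟘 Fin.≟ j) (sym j≡0)))
  ... | no j≢0 = trans (⌊⌋-false (toℕ j ℕ.≟ p) (ℕP.<⇒≢ (FinP.toℕ<n j)))
                       (sym (⌊⌋-false (𝟘 Fin.≟ j) (λ e → j≢0 (sym e))))

  𝟙 : F p
  𝟙 = ι 1

  module Field (p-prime : Prime p) where

    1<p : 1 <ℕ p
    1<p = ℕ.nonTrivial⇒n>1 p {{prime⇒nonTrivial p-prime}}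

    toℕ-𝟙 : toℕ 𝟙 ≡ 1
    toℕ-𝟙 = ι-< 1<p

    𝟙≢𝟘 : 𝟙 ≢ 𝟘
    𝟙≢𝟘 e with trans (sym toℕ-𝟙) (trans (cong toℕ e) toℕ-𝟘)
    ... | ()

    ⊗-identityˡ : ∀ a → 𝟙 ⊗ a ≡ a
    ⊗-identityˡ a = trans (cong (λ z → ι (z *ℕ toℕ a)) toℕ-𝟙) (trans (cong ι (ℕP.*-identityˡ (toℕ a))) (ι-toℕ a))

    ⊗-identityʳ : ∀ a → a ⊗ 𝟙 ≡ a
    ⊗-identityʳ a = trans (⊗-comm a 𝟙) (⊗-identityˡ a)

    inverse : ∀ a → a ≢ 𝟘 → Σ (F p) (λ b → a ⊗ b ≡ 𝟙)
    inverse a a≢0 with coprime-Bézout (prime⇒coprime p-prime {{ℕ.≢-nonZero (≢𝟘⇒toℕ≢0 a≢0)}} (FinP.toℕ<n a))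
    ... | GCD.Bézout.-+ x y eq = ι y , (begin
      a ⊗ ι y                    ≡⟨ cong (_⊗ ι y) (ι-toℕ a) ⟨
      ι (toℕ a) ⊗ ι y            ≡⟨ ι-* (toℕ a) y ⟨
      ι (toℕ a *ℕ y)             ≡⟨ cong ι (trans (ℕP.*-comm (toℕ a) y) (sym eq)) ⟩
      ι (1 +ℕ x *ℕ p)            ≡⟨ ι-cong ([m+kn]%n≡m%n 1 x p) ⟩
      𝟙 ∎)
    ... | GCD.Bézout.+- x y eq = ⊖ (ι y) , trans (⊗-⊖ʳ a (ι y)) (sym (⊖-unique (a ⊗ ι y) 𝟙 (begin
      a ⊗ ι y ⊕ 𝟙                ≡⟨ cong (λ z → z ⊗ ι y ⊕ 𝟙) (ι-toℕ a) ⟨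
      ι (toℕ a) ⊗ ι y ⊕ ι 1      ≡⟨ cong (_⊕ ι 1) (ι-* (toℕ a) y) ⟨
      ι (toℕ a *ℕ y) ⊕ ι 1       ≡⟨ ι-+ _ 1 ⟨
      ι (toℕ a *ℕ y +ℕ 1)
        ≡⟨ cong ι (trans (ℕP.+-comm _ 1) (trans (cong (1 +ℕ_) (ℕP.*-comm (toℕ a) y)) eq)) ⟩
      ι (x *ℕ p)                 ≡⟨ ι-cong (trans (m*n%n≡0 x p) (sym (m<n⇒m%n≡m (ℕ.>-nonZero⁻¹ p)))) ⟩
      𝟘 ∎)))

allFin-enumeration : ∀ n → IsEnumeration Fin._≟_ (allFin n)
allFin-enumeration (suc n) zero =
  cong (_+_ (+ 1)) (trans (∑-tabulate n suc (λ a → χ ⌊ a Fin.≟ zero ⌋)) (∑-zero (allFin n)))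
allFin-enumeration (suc n) (suc b) = begin
  + 0 + ∑ (tabulate {n = n} suc) (λ a → χ ⌊ a Fin.≟ suc b ⌋)   ≡⟨ +-identityˡ _ ⟩
  ∑ (tabulate {n = n} suc) (λ a → χ ⌊ a Fin.≟ suc b ⌋)         ≡⟨ ∑-tabulate n suc _ ⟩
  ∑ (allFin n) (λ a → χ ⌊ suc a Fin.≟ suc b ⌋)
    ≡⟨ ∑-cong (allFin n) (λ a → cong χ (suc≟suc a)) ⟩
  ∑ (allFin n) (λ a → χ ⌊ a Fin.≟ b ⌋)                         ≡⟨ allFin-enumeration n b ⟩
  + 1 ∎
  where
  open ≡-Reasoning
  suc≟suc : ∀ a → ⌊ suc a Fin.≟ suc b ⌋ ≡ ⌊ a Fin.≟ b ⌋
  suc≟suc a = ⌊⌋-⇔ (mk⇔ FinP.suc-injective (cong suc)) (suc a Fin.≟ suc b) (a Fin.≟ b)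

module Vectors (p : ℕ) {{_ : NonZero p}} where

  open GF p
  open ≡-Reasoning

  infix 4 _≟ᵥ_
  infixl 6 _+ᵥ_ _-ᵥ_

  _≟ᵥ_ : ∀ {n} → DecidableEquality (Pt p n)
  _≟ᵥ_ = VecP.≡-dec Fin._≟_

  0ᵥ : ∀ {n} → Pt p n
  0ᵥ = vzero p

  -ᵥ_ : ∀ {n} → Pt p n → Pt p n
  -ᵥ_ = vneg p

  _+ᵥ_ _-ᵥ_ : ∀ {n} → Pt p n → Pt p n → Pt p n
  _+ᵥ_ = Data.Vec.zipWith _⊕_
  _-ᵥ_ = vsub p

  ⟨_,_⟩ : ∀ {n} → Pt p n → Pt p n → F p
  ⟨_,_⟩ = dot p

  ⟨⟩-comm : ∀ {n} (x y : Pt p n) → ⟨ x , y ⟩ ≡ ⟨ y , x ⟩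
  ⟨⟩-comm [] [] = refl
  ⟨⟩-comm (a ∷ x) (b ∷ y) = cong₂ _⊕_ (⊗-comm a b) (⟨⟩-comm x y)

  ⟨⟩-+ᵥʳ : ∀ {n} (x y z : Pt p n) → ⟨ x , y +ᵥ z ⟩ ≡ ⟨ x , y ⟩ ⊕ ⟨ x , z ⟩
  ⟨⟩-+ᵥʳ [] [] [] = sym (⊕-identityˡ 𝟘)
  ⟨⟩-+ᵥʳ (a ∷ x) (b ∷ y) (c ∷ z) =
    trans (cong₂ _⊕_ (⊗-distribˡ-⊕ a b c) (⟨⟩-+ᵥʳ x y z)) (⊕-interchange (a ⊗ b) (a ⊗ c) ⟨ x , y ⟩ ⟨ x , z ⟩)

  ⟨⟩-+ᵥˡ : ∀ {n} (x y z : Pt p n) → ⟨ x +ᵥ y , z ⟩ ≡ ⟨ x , z ⟩ ⊕ ⟨ y , z ⟩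
  ⟨⟩-+ᵥˡ x y z = trans (⟨⟩-comm _ z) (trans (⟨⟩-+ᵥʳ z x y) (cong₂ _⊕_ (⟨⟩-comm z x) (⟨⟩-comm z y)))

  ⟨⟩--ᵥʳ : ∀ {n} (x y : Pt p n) → ⟨ x , -ᵥ y ⟩ ≡ ⊖ ⟨ x , y ⟩
  ⟨⟩--ᵥʳ [] [] = sym ⊖-𝟘
  ⟨⟩--ᵥʳ (a ∷ x) (b ∷ y) = trans (cong₂ _⊕_ (⊗-⊖ʳ a b) (⟨⟩--ᵥʳ x y)) (sym (⊖-distrib-⊕ (a ⊗ b) ⟨ x , y ⟩))

  ⟨⟩-0ᵥʳ : ∀ {n} (x : Pt p n) → ⟨ x , 0ᵥ ⟩ ≡ 𝟘
  ⟨⟩-0ᵥʳ [] = refl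
  ⟨⟩-0ᵥʳ (a ∷ x) = trans (cong₂ _⊕_ (⊗-zeroʳ a) (⟨⟩-0ᵥʳ x)) (⊕-identityˡ 𝟘)

  ⟨⟩-0ᵥˡ : ∀ {n} (x : Pt p n) → ⟨ 0ᵥ , x ⟩ ≡ 𝟘
  ⟨⟩-0ᵥˡ x = trans (⟨⟩-comm 0ᵥ x) (⟨⟩-0ᵥʳ x)

  -ᵥ≡+ᵥ-ᵥ : ∀ {n} (x y : Pt p n) → x -ᵥ y ≡ x +ᵥ (-ᵥ y)
  -ᵥ≡+ᵥ-ᵥ [] [] = refl
  -ᵥ≡+ᵥ-ᵥ (a ∷ x) (b ∷ y) = cong (a ⊝ b ∷_) (-ᵥ≡+ᵥ-ᵥ x y)

  +ᵥ-comm : ∀ {n} (x y : Pt p n) → x +ᵥ y ≡ y +ᵥ x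
  +ᵥ-comm [] [] = refl
  +ᵥ-comm (a ∷ x) (b ∷ y) = cong₂ _∷_ (⊕-comm a b) (+ᵥ-comm x y)

  +ᵥ-assoc : ∀ {n} (x y z : Pt p n) → x +ᵥ y +ᵥ z ≡ x +ᵥ (y +ᵥ z)
  +ᵥ-assoc [] [] [] = refl
  +ᵥ-assoc (a ∷ x) (b ∷ y) (c ∷ z) = cong₂ _∷_ (⊕-assoc a b c) (+ᵥ-assoc x y z)

  +ᵥ-identityʳ : ∀ {n} (x : Pt p n) → x +ᵥ 0ᵥ ≡ x
  +ᵥ-identityʳ [] = refl
  +ᵥ-identityʳ (a ∷ x) = cong₂ _∷_ (⊕-identityʳ a) (+ᵥ-identityʳ x)

  +ᵥ-identityˡ : ∀ {n} (x : Pt p n) → 0ᵥ +ᵥ x ≡ x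
  +ᵥ-identityˡ x = trans (+ᵥ-comm 0ᵥ x) (+ᵥ-identityʳ x)

  +ᵥ-inverseʳ : ∀ {n} (x : Pt p n) → x +ᵥ (-ᵥ x) ≡ 0ᵥ
  +ᵥ-inverseʳ [] = refl
  +ᵥ-inverseʳ (a ∷ x) = cong₂ _∷_ (⊕-inverseʳ a) (+ᵥ-inverseʳ x)

  +ᵥ-inverseˡ : ∀ {n} (x : Pt p n) → (-ᵥ x) +ᵥ x ≡ 0ᵥ
  +ᵥ-inverseˡ x = trans (+ᵥ-comm _ x) (+ᵥ-inverseʳ x)

  -ᵥ-involutive : ∀ {n} (x : Pt p n) → -ᵥ (-ᵥ x) ≡ x
  -ᵥ-involutive [] = refl
  -ᵥ-involutive (a ∷ x) = cong₂ _∷_ (⊖-involutive a) (-ᵥ-involutive x)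

  -ᵥ0ᵥ : ∀ {n} → -ᵥ 0ᵥ ≡ 0ᵥ {n}
  -ᵥ0ᵥ {zero} = refl
  -ᵥ0ᵥ {suc n} = cong₂ _∷_ ⊖-𝟘 -ᵥ0ᵥ

  0ᵥ-ᵥ : ∀ {n} (x : Pt p n) → 0ᵥ -ᵥ x ≡ -ᵥ x
  0ᵥ-ᵥ x = trans (-ᵥ≡+ᵥ-ᵥ 0ᵥ x) (+ᵥ-identityˡ _)

  x-ᵥ0ᵥ : ∀ {n} (x : Pt p n) → x -ᵥ 0ᵥ ≡ x
  x-ᵥ0ᵥ x = trans (-ᵥ≡+ᵥ-ᵥ x 0ᵥ) (trans (cong (x +ᵥ_) -ᵥ0ᵥ) (+ᵥ-identityʳ x))

  x-ᵥx : ∀ {n} (x : Pt p n) → x -ᵥ x ≡ 0ᵥ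
  x-ᵥx x = trans (-ᵥ≡+ᵥ-ᵥ x x) (+ᵥ-inverseʳ x)

  -ᵥ-+ᵥ-cancel : ∀ {n} (y a : Pt p n) → y -ᵥ a +ᵥ a ≡ y
  -ᵥ-+ᵥ-cancel y a = begin
    y -ᵥ a +ᵥ a              ≡⟨ cong (_+ᵥ a) (-ᵥ≡+ᵥ-ᵥ y a) ⟩
    y +ᵥ (-ᵥ a) +ᵥ a         ≡⟨ +ᵥ-assoc y _ a ⟩
    y +ᵥ ((-ᵥ a) +ᵥ a)       ≡⟨ cong (y +ᵥ_) (+ᵥ-inverseˡ a) ⟩
    y +ᵥ 0ᵥ                  ≡⟨ +ᵥ-identityʳ y ⟩
    y ∎

  +ᵥ--ᵥ-cancel : ∀ {n} (y a : Pt p n) → y +ᵥ a -ᵥ a ≡ y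
  +ᵥ--ᵥ-cancel y a = begin
    y +ᵥ a -ᵥ a              ≡⟨ -ᵥ≡+ᵥ-ᵥ _ a ⟩
    y +ᵥ a +ᵥ (-ᵥ a)         ≡⟨ +ᵥ-assoc y a _ ⟩
    y +ᵥ (a +ᵥ (-ᵥ a))       ≡⟨ cong (y +ᵥ_) (+ᵥ-inverseʳ a) ⟩
    y +ᵥ 0ᵥ                  ≡⟨ +ᵥ-identityʳ y ⟩
    y ∎

  -ᵥ≡0ᵥ⇒≡0ᵥ : ∀ {n} (x : Pt p n) → -ᵥ x ≡ 0ᵥ → x ≡ 0ᵥ
  -ᵥ≡0ᵥ⇒≡0ᵥ x e = trans (sym (-ᵥ-involutive x)) (trans (cong -ᵥ_ e) -ᵥ0ᵥ)

  +ᵥ≡0ᵥ⇒≡-ᵥ : ∀ {n} (x z : Pt p n) → x +ᵥ z ≡ 0ᵥ → z ≡ -ᵥ x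
  +ᵥ≡0ᵥ⇒≡-ᵥ x z e = begin
    z                        ≡⟨ +ᵥ-identityˡ z ⟨
    0ᵥ +ᵥ z                  ≡⟨ cong (_+ᵥ z) (+ᵥ-inverseˡ x) ⟨
    (-ᵥ x) +ᵥ x +ᵥ z         ≡⟨ +ᵥ-assoc _ x z ⟩
    (-ᵥ x) +ᵥ (x +ᵥ z)       ≡⟨ cong ((-ᵥ x) +ᵥ_) e ⟩
    (-ᵥ x) +ᵥ 0ᵥ             ≡⟨ +ᵥ-identityʳ _ ⟩
    -ᵥ x ∎

  ∃-⟨⟩≡𝟙 : Prime p → ∀ {n} (x : Pt p n) → x ≢ 0ᵥ → Σ (Pt p n) (λ e → ⟨ x , e ⟩ ≡ 𝟙)
  ∃-⟨⟩≡𝟙 p-prime [] x≢0 = ⊥-elim (x≢0 refl)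
  ∃-⟨⟩≡𝟙 p-prime (a ∷ x) x≢0 with a Fin.≟ 𝟘
  ... | no a≢0 = let (a⁻¹ , aa⁻¹≡1) = Field.inverse p-prime a a≢0 in
    (a⁻¹ ∷ 0ᵥ) , trans (cong₂ _⊕_ aa⁻¹≡1 (⟨⟩-0ᵥʳ x)) (⊕-identityʳ 𝟙)
  ... | yes refl = let (e , xe≡1) = ∃-⟨⟩≡𝟙 p-prime x (λ x≡0 → x≢0 (cong (𝟘 ∷_) x≡0)) in
    (𝟘 ∷ e) , trans (cong₂ _⊕_ (⊗-zeroʳ 𝟘) xe≡1) (⊕-identityˡ 𝟙)

  ∑-allPts-suc : ∀ n (g : Pt p (suc n) → ℤ) →
                 ∑ (allPts p (suc n)) g ≡ ∑ (allFin p) (λ a → ∑ (allPts p n) (λ v → g (a ∷ v)))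
  ∑-allPts-suc n g = trans (∑-concatMap (allFin p) _ g) (∑-cong (allFin p) (λ a → ∑-map (allPts p n) (a ∷_) g))

  module ∑F = Enumeration Fin._≟_ (allFin p) (allFin-enumeration p)

  ∑-allPts-one : ∀ n → ∑ (allPts p n) (λ _ → + 1) ≡ + (p ^ℕ n)
  ∑-allPts-one zero = refl
  ∑-allPts-one (suc n) = begin
    ∑ (allPts p (suc n)) (λ _ → + 1)               ≡⟨ ∑-allPts-suc n _ ⟩
    ∑ (allFin p) (λ a → ∑ (allPts p n) (λ _ → + 1)) ≡⟨ ∑-const (allFin p) _ ⟩
    + length (allFin p) * ∑ (allPts p n) (λ _ → + 1)
      ≡⟨ cong₂ (λ l s → + l * s) (length-tabulate {n = p} (λ x → x)) (∑-allPts-one n) ⟩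
    + p * + (p ^ℕ n)                               ≡⟨ pos-* p (p ^ℕ n) ⟨
    + (p ^ℕ suc n) ∎

  χ-∷ : ∀ {n} (a b : F p) (v w : Pt p n) → χ ⌊ (a ∷ v) ≟ᵥ (b ∷ w) ⌋ ≡ χ ⌊ a Fin.≟ b ⌋ * χ ⌊ v ≟ᵥ w ⌋
  χ-∷ a b v w with a Fin.≟ b | v ≟ᵥ w
  ... | yes _ | yes _ = refl
  ... | yes _ | no _  = refl
  ... | no _  | _     = refl

  allPts-enumeration : ∀ n → IsEnumeration _≟ᵥ_ (allPts p n)
  allPts-enumeration zero [] = refl
  allPts-enumeration (suc n) (b ∷ w) = begin
    ∑ (allPts p (suc n)) (λ a → χ ⌊ a ≟ᵥ (b ∷ w) ⌋)                         ≡⟨ ∑-allPts-suc n _ ⟩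
    ∑ (allFin p) (λ a → ∑ (allPts p n) (λ v → χ ⌊ (a ∷ v) ≟ᵥ (b ∷ w) ⌋))
      ≡⟨ ∑-cong (allFin p) (λ a → ∑-cong (allPts p n) (λ v → χ-∷ a b v w)) ⟩
    ∑ (allFin p) (λ a → ∑ (allPts p n) (λ v → χ ⌊ a Fin.≟ b ⌋ * χ ⌊ v ≟ᵥ w ⌋))
      ≡⟨ ∑-cong (allFin p) (λ a → trans (∑-*ˡ (allPts p n) (χ ⌊ a Fin.≟ b ⌋) (λ v → χ ⌊ v ≟ᵥ w ⌋))
                                        (cong (χ ⌊ a Fin.≟ b ⌋ *_) (allPts-enumeration n w))) ⟩
    ∑ (allFin p) (λ a → χ ⌊ a Fin.≟ b ⌋ * + 1)                               ≡⟨ ∑F.∑-δ b (λ _ → + 1) ⟩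
    + 1 ∎

  module ∑Pt (n : ℕ) = Enumeration (_≟ᵥ_ {n}) (allPts p n) (allPts-enumeration n)

module Cyclotomic (p : ℕ) {{_ : NonZero p}} where

  open GF p
  open Vectors p using (module ∑F)
  open ≡-Reasoning

  infix 4 _≈_
  infixl 6 _+ᶜ_
  infixl 7 _·_ _∗_

  ℤζ : Set
  ℤζ = Cyc p

  -- Defs._≈_ as a record, so that a and b are inferable from a ≈ b.
  record _≈_ (a b : ℤζ) : Set where
    constructor mk≈
    field
      offset : ℤ
      pointwise : ∀ k → a k ≡ b k + offset

  ≈⇒Defs≈ : ∀ {a b} → a ≈ b → Defs._≈_ p a b
  ≈⇒Defs≈ (mk≈ c e) = c , e

  Defs≈⇒≈ : ∀ {a b} → Defs._≈_ p a b → a ≈ b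
  Defs≈⇒≈ (c , e) = mk≈ c e

  ∑F : (F p → ℤ) → ℤ
  ∑F = ∑ (allFin p)

  ζ^_ : F p → ℤζ
  (ζ^ a) k = χ (feq p a k)

  _+ᶜ_ : ℤζ → ℤζ → ℤζ
  _+ᶜ_ = cadd p

  _·_ : ℤ → ℤζ → ℤζ
  (c · a) k = c * a k

  _∗_ : ℤζ → ℤζ → ℤζ
  (a ∗ b) k = ∑F (λ i → a i * b (k ⊝ i))

  -- complex conjugation ζ ↦ ζ⁻¹
  σ : ℤζ → ℤζ
  σ a k = a (⊖ k)

  mono≗· : ∀ j c → mono p j c ≗ c · ζ^ j
  mono≗· j c k with feq p j k
  ... | true = sym (*-identityʳ c)
  ... | false = sym (*-zeroʳ c)

  ζ^-diag : ∀ a → (ζ^ a) a ≡ + 1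
  ζ^-diag a = cong χ (⌊⌋-true (a Fin.≟ a) refl)

  ζ^-sym : ∀ a b → (ζ^ a) b ≡ (ζ^ b) a
  ζ^-sym a b = cong χ (⌊≟⌋-sym Fin._≟_ a b)

  ζ^-⊝ : ∀ a b k → (ζ^ a) (k ⊝ b) ≡ (ζ^ (a ⊕ b)) k
  ζ^-⊝ a b k = cong χ (⌊⌋-⇔ (mk⇔ (λ e → trans (cong (_⊕ b) e) (⊝-⊕-cancel k b))
                                  (λ e → trans (sym (⊕-⊝-cancel a b)) (cong (_⊝ b) e)))
                             (a Fin.≟ k ⊝ b) (a ⊕ b Fin.≟ k))

  ζ^-⊕ : ∀ a b k → (ζ^ a) (k ⊕ b) ≡ (ζ^ (a ⊝ b)) k
  ζ^-⊕ a b k = trans (cong (ζ^ a) (cong (k ⊕_) (sym (⊖-involutive b)))) (ζ^-⊝ a (⊖ b) k)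

  ζ^-⊖ : ∀ a k → (ζ^ a) (⊖ k) ≡ (ζ^ (⊖ a)) k
  ζ^-⊖ a k = cong χ (⌊⌋-⇔ (mk⇔ (λ e → trans (cong ⊖ e) (⊖-involutive k))
                                (λ e → trans (sym (⊖-involutive a)) (cong ⊖ e)))
                          (a Fin.≟ ⊖ k) (⊖ a Fin.≟ k))

  ∑F-const : ∀ c → ∑F (λ _ → c) ≡ + p * c
  ∑F-const c = trans (∑-const (allFin p) c) (cong (λ n → + n * c) (length-tabulate {n = p} (λ x → x)))

  ∑F-ζ^ : ∀ k → ∑F (λ j → (ζ^ j) k) ≡ + 1
  ∑F-ζ^ k = allFin-enumeration p k

  ∑F-⊝ : ∀ k (g : F p → ℤ) → ∑F (λ i → g (k ⊝ i)) ≡ ∑F g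
  ∑F-⊝ k = ∑F.∑-reindex (k ⊝_) (k ⊝_) (⊝-cancelˡ k) (⊝-cancelˡ k)

  ∑F-⊕ : ∀ j (g : F p → ℤ) → ∑F (λ i → g (i ⊕ j)) ≡ ∑F g
  ∑F-⊕ j = ∑F.∑-reindex (_⊕ j) (_⊝ j) (λ l → ⊕-⊝-cancel l j) (λ l → ⊝-⊕-cancel l j)

  ∑F-⊖ : ∀ (g : F p → ℤ) → ∑F (λ i → g (⊖ i)) ≡ ∑F g
  ∑F-⊖ = ∑F.∑-reindex ⊖ ⊖ ⊖-involutive ⊖-involutive

  ≈-refl : ∀ {a} → a ≈ a
  ≈-refl = mk≈ (+ 0) λ k → sym (+-identityʳ _)

  ≈-sym : ∀ {a b} → a ≈ b → b ≈ a
  ≈-sym {a} {b} (mk≈ c e) = mk≈ (- c) λ k → trans (sym (+-cancel (b k) c)) (cong (_+ - c) (sym (e k)))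
    where +-cancel : ∀ x y → x + y + - y ≡ x
          +-cancel = solve-∀

  ≈-trans : ∀ {a b d} → a ≈ b → b ≈ d → a ≈ d
  ≈-trans {d = d} (mk≈ c e) (mk≈ c′ e′) =
    mk≈ (c′ + c) λ k → trans (e k) (trans (cong (_+ c) (e′ k)) (+-assoc (d k) c′ c))

  ≈-setoid : Setoid _ _
  ≈-setoid = record
    { Carrier = ℤζ ; _≈_ = _≈_ ; isEquivalence = record { refl = ≈-refl ; sym = ≈-sym ; trans = ≈-trans } }

  module ≈-Reasoning = Relation.Binary.Reasoning.Setoid ≈-setoid

  ≗⇒≈ : ∀ {a b} → a ≗ b → a ≈ b
  ≗⇒≈ e = mk≈ (+ 0) λ k → trans (e k) (sym (+-identityʳ _))

  constant≈0 : ∀ c → (λ _ → c) ≈ czero p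
  constant≈0 c = mk≈ c λ k → sym (+-identityˡ c)

  ≈0⇒+ᶜ≈ : ∀ a {b} → b ≈ czero p → a +ᶜ b ≈ a
  ≈0⇒+ᶜ≈ a (mk≈ c h) = mk≈ c λ k → cong (_+_ (a k)) (trans (h k) (+-identityˡ c))

  +ᶜ-cong : ∀ {a b a′ b′} → a ≈ a′ → b ≈ b′ → a +ᶜ b ≈ a′ +ᶜ b′
  +ᶜ-cong {a′ = a′} {b′ = b′} (mk≈ c e) (mk≈ c′ e′) =
    mk≈ (c + c′) λ k → trans (cong₂ _+_ (e k) (e′ k)) (+-interchange (a′ k) c (b′ k) c′)
    where +-interchange : ∀ w x y z → w + x + (y + z) ≡ w + y + (x + z)
          +-interchange = solve-∀

  ·-cong : ∀ s {a b} → a ≈ b → s · a ≈ s · b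
  ·-cong s {b = b} (mk≈ c e) = mk≈ (s * c) λ k → trans (cong (s *_) (e k)) (*-distribˡ-+ s (b k) c)

  ⊕-cong : ∀ {a b} j → a ≈ b → (λ k → a (k ⊕ j)) ≈ (λ k → b (k ⊕ j))
  ⊕-cong j (mk≈ c h) = mk≈ c λ k → h (k ⊕ j)

  ∑ᶜ : {A : Set} → List A → (A → ℤζ) → ℤζ
  ∑ᶜ L u k = ∑ L (λ j → u j k)

  csum≗∑ᶜ : ∀ {A : Set} (L : List A) (h : A → ℤζ) → csum p (map h L) ≗ ∑ᶜ L h
  csum≗∑ᶜ [] h k = refl
  csum≗∑ᶜ (a ∷ L) h k = cong (_+_ (h a k)) (csum≗∑ᶜ L h k)

  ∑ᶜ-cong : ∀ {A : Set} (L : List A) {u w : A → ℤζ} → (∀ j → u j ≈ w j) → ∑ᶜ L u ≈ ∑ᶜ L w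
  ∑ᶜ-cong L h = mk≈ (∑ L (λ j → _≈_.offset (h j)))
                    λ k → trans (∑-cong L (λ j → _≈_.pointwise (h j) k)) (∑-distrib-+ L _ _)

  -- The offset is read off at the coefficient of ζ^𝟘.
  ·-cancel : ∀ (s : ℤ) .{{_ : NonZeroℤ s}} {a b : ℤζ} → s · a ≈ s · b → a ≈ b
  ·-cancel s {a} {b} (mk≈ c e) = mk≈ (a 𝟘 - b 𝟘) λ k → *-cancelˡ-≡ s (a k) (b k + (a 𝟘 - b 𝟘)) (begin
    s * a k                        ≡⟨ e k ⟩
    s * b k + c                    ≡⟨ cong (_+_ (s * b k)) c≡ ⟩
    s * b k + s * (a 𝟘 - b 𝟘)      ≡⟨ *-distribˡ-+ s (b k) _ ⟨
    s * (b k + (a 𝟘 - b 𝟘)) ∎)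
    where
    c≡ : c ≡ s * (a 𝟘 - b 𝟘)
    c≡ = begin
      c                              ≡⟨ +-cancelˡ (s * b 𝟘) c ⟨
      s * b 𝟘 + c - s * b 𝟘          ≡⟨ cong (_- s * b 𝟘) (e 𝟘) ⟨
      s * a 𝟘 - s * b 𝟘              ≡⟨ *-distribˡ-- s (a 𝟘) (b 𝟘) ⟨
      s * (a 𝟘 - b 𝟘) ∎
      where +-cancelˡ : ∀ x y → x + y - x ≡ y
            +-cancelˡ = solve-∀
            *-distribˡ-- : ∀ s x y → s * (x - y) ≡ s * x - s * y
            *-distribˡ-- = solve-∀

  ∗-comm : ∀ a b → a ∗ b ≗ b ∗ a
  ∗-comm a b k = begin
    ∑F (λ i → a i * b (k ⊝ i))                   ≡⟨ ∑F-⊝ k _ ⟨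
    ∑F (λ i → a (k ⊝ i) * b (k ⊝ (k ⊝ i)))
      ≡⟨ ∑-cong (allFin p) (λ i → trans (cong (λ z → a (k ⊝ i) * b z) (⊝-cancelˡ k i)) (*-comm (a (k ⊝ i)) (b i))) ⟩
    ∑F (λ i → b i * a (k ⊝ i)) ∎

  ∗-assoc : ∀ a b c → (a ∗ b) ∗ c ≗ a ∗ (b ∗ c)
  ∗-assoc a b c k = begin
    ∑F (λ i → ∑F (λ j → a j * b (i ⊝ j)) * c (k ⊝ i))
      ≡⟨ ∑-cong (allFin p) (λ i → ∑-*ʳ (allFin p) (c (k ⊝ i)) _) ⟨
    ∑F (λ i → ∑F (λ j → a j * b (i ⊝ j) * c (k ⊝ i)))              ≡⟨ ∑-comm (allFin p) (allFin p) _ ⟩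
    ∑F (λ j → ∑F (λ i → a j * b (i ⊝ j) * c (k ⊝ i)))              ≡⟨ ∑-cong (allFin p) (λ j → ∑F-⊕ j _) ⟨
    ∑F (λ j → ∑F (λ l → a j * b (l ⊕ j ⊝ j) * c (k ⊝ (l ⊕ j))))
      ≡⟨ ∑-cong (allFin p) (λ j → ∑-cong (allFin p) (λ l → reindexed j l)) ⟩
    ∑F (λ j → ∑F (λ l → a j * (b l * c (k ⊝ j ⊝ l))))
      ≡⟨ ∑-cong (allFin p) (λ j → ∑-*ˡ (allFin p) (a j) _) ⟩
    ∑F (λ j → a j * ∑F (λ l → b l * c (k ⊝ j ⊝ l))) ∎
    where
    reindexed : ∀ j l → a j * b (l ⊕ j ⊝ j) * c (k ⊝ (l ⊕ j)) ≡ a j * (b l * c (k ⊝ j ⊝ l))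
    reindexed j l = trans (cong₂ (λ u v → a j * b u * c v) (⊕-⊝-cancel l j) (⊝-⊕ k l j)) (*-assoc (a j) _ _)

  ∗-distribˡ-+ᶜ : ∀ a b d → a ∗ (b +ᶜ d) ≗ a ∗ b +ᶜ a ∗ d
  ∗-distribˡ-+ᶜ a b d k = trans (∑-cong (allFin p) (λ i → *-distribˡ-+ (a i) _ _)) (∑-distrib-+ (allFin p) _ _)

  ∗-distribʳ-+ᶜ : ∀ a b d → (a +ᶜ b) ∗ d ≗ a ∗ d +ᶜ b ∗ d
  ∗-distribʳ-+ᶜ a b d k =
    trans (∗-comm (a +ᶜ b) d k) (trans (∗-distribˡ-+ᶜ d a b k) (cong₂ _+_ (∗-comm d a k) (∗-comm d b k)))

  ∗-·ʳ : ∀ s a b → a ∗ (s · b) ≗ s · (a ∗ b)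
  ∗-·ʳ s a b k = trans (∑-cong (allFin p) (λ i → *-left-comm (a i) s _)) (∑-*ˡ (allFin p) s _)
    where *-left-comm : ∀ x y z → x * (y * z) ≡ y * (x * z)
          *-left-comm = solve-∀

  ∗-·ˡ : ∀ s a b → (s · a) ∗ b ≗ s · (a ∗ b)
  ∗-·ˡ s a b k = trans (∗-comm (s · a) b k) (trans (∗-·ʳ s b a k) (cong (s *_) (∗-comm b a k)))

  ∗-∑ᶜˡ : ∀ {A : Set} (L : List A) (a : A → ℤζ) b → ∑ᶜ L a ∗ b ≗ ∑ᶜ L (λ j → a j ∗ b)
  ∗-∑ᶜˡ L a b k = trans (∑-cong (allFin p) (λ i → sym (∑-*ʳ L (b (k ⊝ i)) (λ j → a j i)))) (∑-comm (allFin p) L _)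

  ∗-∑ᶜʳ : ∀ {A : Set} (L : List A) a (b : A → ℤζ) → a ∗ ∑ᶜ L b ≗ ∑ᶜ L (λ j → a ∗ b j)
  ∗-∑ᶜʳ L a b k = trans (∑-cong (allFin p) (λ i → sym (∑-*ˡ L (a i) (λ j → b j (k ⊝ i))))) (∑-comm (allFin p) L _)

  ζ^-∗ : ∀ j a → ζ^ j ∗ a ≗ (λ k → a (k ⊝ j))
  ζ^-∗ j a k = ∑F.∑-δ′ j (λ i → a (k ⊝ i))

  ∗-unitˡ : ∀ a → ζ^ 𝟘 ∗ a ≗ a
  ∗-unitˡ a k = trans (ζ^-∗ 𝟘 a k) (cong a (⊝-𝟘 k))

  ∗-zeroʳ : ∀ a → a ∗ czero p ≗ czero p
  ∗-zeroʳ a k = trans (∑-cong (allFin p) (λ i → *-zeroʳ (a i))) (∑-zero (allFin p))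

  ∑F-∗ : ∀ a b → ∑F (a ∗ b) ≡ ∑F a * ∑F b
  ∑F-∗ a b = begin
    ∑F (λ k → ∑F (λ i → a i * b (k ⊝ i)))    ≡⟨ ∑-comm (allFin p) (allFin p) _ ⟩
    ∑F (λ i → ∑F (λ k → a i * b (k ⊝ i)))
      ≡⟨ ∑-cong (allFin p) (λ i → trans (∑-*ˡ (allFin p) (a i) _) (cong (a i *_) (∑-shift i))) ⟩
    ∑F (λ i → a i * ∑F b)                    ≡⟨ ∑-*ʳ (allFin p) (∑F b) a ⟩
    ∑F a * ∑F b ∎
    where
    ∑-shift : ∀ i → ∑F (λ k → b (k ⊝ i)) ≡ ∑F b
    ∑-shift i = trans (sym (∑F-⊕ i _)) (∑-cong (allFin p) (λ l → cong b (⊕-⊝-cancel l i)))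

  ∗-congʳ : ∀ a {b b′} → b ≈ b′ → a ∗ b ≈ a ∗ b′
  ∗-congʳ a {b} {b′} (mk≈ c e) = mk≈ (∑F a * c) λ k → begin
    ∑F (λ i → a i * b (k ⊝ i))
      ≡⟨ ∑-cong (allFin p) (λ i → trans (cong (a i *_) (e (k ⊝ i))) (*-distribˡ-+ (a i) _ c)) ⟩
    ∑F (λ i → a i * b′ (k ⊝ i) + a i * c)         ≡⟨ ∑-distrib-+ (allFin p) _ _ ⟩
    (a ∗ b′) k + ∑F (λ i → a i * c)               ≡⟨ cong (_+_ ((a ∗ b′) k)) (∑-*ʳ (allFin p) c a) ⟩
    (a ∗ b′) k + ∑F a * c ∎

  ∗-cong : ∀ {a a′ b b′} → a ≈ a′ → b ≈ b′ → a ∗ b ≈ a′ ∗ b′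
  ∗-cong {a} {a′} {b} {b′} a≈a′ b≈b′ =
    ≈-trans (≗⇒≈ (∗-comm a b)) (≈-trans (∗-congʳ b a≈a′) (≈-trans (≗⇒≈ (∗-comm b a′)) (∗-congʳ a′ b≈b′)))

  ∗-interchange : ∀ a b → (a ∗ b) ∗ (a ∗ b) ≗ (a ∗ a) ∗ (b ∗ b)
  ∗-interchange a b k = begin
    ((a ∗ b) ∗ (a ∗ b)) k    ≡⟨ ∗-assoc a b (a ∗ b) k ⟩
    (a ∗ (b ∗ (a ∗ b))) k    ≡⟨ ∑-cong (allFin p) (λ i → cong (a i *_) (middle (k ⊝ i))) ⟩
    (a ∗ (a ∗ (b ∗ b))) k    ≡⟨ ∗-assoc a a (b ∗ b) k ⟨
    ((a ∗ a) ∗ (b ∗ b)) k ∎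
    where
    middle : b ∗ (a ∗ b) ≗ a ∗ (b ∗ b)
    middle q = trans (sym (∗-assoc b a b q))
                     (trans (∑-cong (allFin p) (λ i → cong (_* b (q ⊝ i)) (∗-comm b a i))) (∗-assoc a b b q))

  ∗-left-comm : ∀ a b c → a ∗ (b ∗ c) ≗ b ∗ (a ∗ c)
  ∗-left-comm a b c k = begin
    (a ∗ (b ∗ c)) k    ≡⟨ ∗-assoc a b c k ⟨
    ((a ∗ b) ∗ c) k    ≡⟨ ∑-cong (allFin p) (λ i → cong (_* c (k ⊝ i)) (∗-comm a b i)) ⟩
    ((b ∗ a) ∗ c) k    ≡⟨ ∗-assoc b a c k ⟩
    (b ∗ (a ∗ c)) k ∎

  ∑ᶜ-single : ∀ (u : F p → ℤζ) l → (∀ j → j ≢ l → u j ≈ czero p) → ∑ᶜ (allFin p) u ≈ u l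
  ∑ᶜ-single u l others≈0 =
    ≈-trans (∑ᶜ-cong (allFin p) (λ j → only-l j (j Fin.≟ l))) (≗⇒≈ (λ k → ∑F.∑-δ′ l (λ j → u j k)))
    where
    only-l : ∀ j → Dec (j ≡ l) → u j ≈ (ζ^ l) j · u j
    only-l j (yes refl) = ≗⇒≈ (λ k → sym (trans (cong (_* u j k) (ζ^-diag j)) (*-identityˡ (u j k))))
    only-l j (no j≢l) =
      ≈-trans (others≈0 j j≢l) (≗⇒≈ (λ k → sym (cong (λ b → χ b * u j k) (⌊⌋-false (l Fin.≟ j) (λ e → j≢l (sym e))))))

  σ-∗ : ∀ a b → σ (a ∗ b) ≗ σ a ∗ σ b
  σ-∗ a b k = begin
    ∑F (λ i → a i * b (⊖ k ⊝ i))              ≡⟨ ∑F-⊖ _ ⟨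
    ∑F (λ i → a (⊖ i) * b (⊖ k ⊝ ⊖ i))
      ≡⟨ ∑-cong (allFin p) (λ i → cong (λ z → a (⊖ i) * b z) (sym (⊖-distrib-⊕ k (⊖ i)))) ⟩
    ∑F (λ i → a (⊖ i) * b (⊖ (k ⊝ i))) ∎

  ζ^-≈-injective : ∀ {a b} → ζ^ a ≈ ζ^ b → a ≡ b
  ζ^-≈-injective {a} {b} (mk≈ c e) with a Fin.≟ b
  ... | yes a≡b = a≡b
  ... | no a≢b = case trans at-b (cong (_+_ (+ 1)) (sym (trans at-a (+-identityˡ c)))) of λ ()
    where
    at-a : + 1 ≡ + 0 + c
    at-a = trans (sym (ζ^-diag a)) (trans (e a) (cong (λ z → χ z + c) (⌊⌋-false (b Fin.≟ a) (λ e → a≢b (sym e)))))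
    at-b : + 0 ≡ + 1 + c
    at-b = trans (sym (cong χ (⌊⌋-false (a Fin.≟ b) a≢b))) (trans (e b) (cong (_+ c) (ζ^-diag b)))

  -- The coefficients are k - μ and λ - μ for the Latin square type parameters
  -- k = (N - 1) r, λ = N + r² - 3r, μ = r² - r.
  latin-square-idempotent : ∀ (H : ℤζ) N r →
    H ∗ H ≈ ((N - + 1) * r - (r * r - r)) · ζ^ 𝟘 +ᶜ ((N + r * r - + 3 * r) - (r * r - r)) · H →
    (H +ᶜ r · ζ^ 𝟘) ∗ (H +ᶜ r · ζ^ 𝟘) ≈ N · (H +ᶜ r · ζ^ 𝟘)
  latin-square-idempotent H N r H² =
    ≈-trans (≗⇒≈ expand) (≈-trans (+ᶜ-cong H² ≈-refl) (≗⇒≈ (λ k → collect N r ((ζ^ 𝟘) k) (H k))))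
    where
    u = H +ᶜ r · ζ^ 𝟘
    expand : u ∗ u ≗ H ∗ H +ᶜ (r · H +ᶜ r · u)
    expand k = begin
      (u ∗ u) k                                      ≡⟨ ∗-distribʳ-+ᶜ H (r · ζ^ 𝟘) u k ⟩
      (H ∗ u) k + ((r · ζ^ 𝟘) ∗ u) k
        ≡⟨ cong₂ _+_ (∗-distribˡ-+ᶜ H H (r · ζ^ 𝟘) k) (trans (∗-·ˡ r (ζ^ 𝟘) u k) (cong (r *_) (∗-unitˡ u k))) ⟩
      (H ∗ H) k + (H ∗ (r · ζ^ 𝟘)) k + r * u k
        ≡⟨ cong (λ z → (H ∗ H) k + z + r * u k)
                (trans (∗-·ʳ r H (ζ^ 𝟘) k) (cong (r *_) (trans (∗-comm H (ζ^ 𝟘) k) (∗-unitˡ H k)))) ⟩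
      (H ∗ H) k + r * H k + r * u k                  ≡⟨ +-assoc ((H ∗ H) k) (r * H k) (r * u k) ⟩
      (H ∗ H) k + (r * H k + r * u k) ∎
    collect : ∀ N r e h → ((N - + 1) * r - (r * r - r)) * e + ((N + r * r - + 3 * r) - (r * r - r)) * h
                          + (r * h + r * (h + r * e)) ≡ N * (h + r * e)
    collect = solve-∀

  -- The trace ℚ(ζ) → ℚ of Σ c_k ζ^k, which is (p - 1) c₀ - Σ_{k ≠ 0} c_k.
  Tr : ℤζ → ℤ
  Tr a = + p * a 𝟘 - ∑F a

  Tr-cong : ∀ {a b} → a ≈ b → Tr a ≡ Tr b
  Tr-cong {a} {b} (mk≈ c e) = begin
    + p * a 𝟘 - ∑F a                     ≡⟨ cong₂ (λ u v → + p * u - v) (e 𝟘) ∑a ⟩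
    + p * (b 𝟘 + c) - (∑F b + + p * c)   ≡⟨ offset-cancels (+ p) (b 𝟘) c (∑F b) ⟩
    + p * b 𝟘 - ∑F b ∎
    where
    ∑a : ∑F a ≡ ∑F b + + p * c
    ∑a = trans (∑-cong (allFin p) e) (trans (∑-distrib-+ (allFin p) b (λ _ → c)) (cong (_+_ (∑F b)) (∑F-const c)))
    offset-cancels : ∀ q x y z → q * (x + y) - (z + q * y) ≡ q * x - z
    offset-cancels = solve-∀

  Tr-· : ∀ s a → Tr (s · a) ≡ s * Tr a
  Tr-· s a = trans (cong (λ z → + p * (s * a 𝟘) - z) (∑-*ˡ (allFin p) s a)) (factor (+ p) s (a 𝟘) (∑F a))
    where factor : ∀ q s x z → q * (s * x) - s * z ≡ s * (q * x - z)
          factor = solve-∀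

  Tr-∑ᶜ : ∀ {A : Set} (L : List A) (u : A → ℤζ) → Tr (∑ᶜ L u) ≡ ∑ L (λ j → Tr (u j))
  Tr-∑ᶜ L u = begin
    + p * ∑ L (λ j → u j 𝟘) - ∑F (λ k → ∑ L (λ j → u j k))
      ≡⟨ cong₂ _-_ (sym (∑-*ˡ L (+ p) _)) (∑-comm (allFin p) L _) ⟩
    ∑ L (λ j → + p * u j 𝟘) - ∑ L (λ j → ∑F (u j))           ≡⟨ ∑-distrib-- L _ _ ⟨
    ∑ L (λ j → Tr (u j)) ∎

  D : ℤζ → ℤ
  D v = ∑F (λ i → ∑F (λ j → (v i - v j) * (v i - v j)))

  square-nonneg : ∀ x → + 0 ≤ x * x
  square-nonneg (+ zero) = +≤+ z≤n
  square-nonneg (+ suc _) = +≤+ z≤n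
  square-nonneg -[1+ _ ] = +≤+ z≤n

  D-nonneg : ∀ v → + 0 ≤ D v
  D-nonneg v = ∑-nonneg (allFin p) (λ i → ∑-nonneg (allFin p) (λ j → square-nonneg (v i - v j)))

  D≡0⇒≈0 : ∀ v → D v ≡ + 0 → v ≈ czero p
  D≡0⇒≈0 v D≡0 = mk≈ (v 𝟘) λ k → trans (all-equal k 𝟘) (sym (+-identityˡ (v 𝟘)))
    where
    row≡0 : ∀ i → ∑F (λ j → (v i - v j) * (v i - v j)) ≡ + 0
    row≡0 = ∑F.nonneg-∑≡0⇒≡0 _ (λ i → ∑-nonneg (allFin p) (λ j → square-nonneg (v i - v j))) D≡0
    square≡0⇒≡0 : ∀ x → x * x ≡ + 0 → x ≡ + 0
    square≡0⇒≡0 x e = reduce (i*j≡0⇒i≡0∨j≡0 x e)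
    all-equal : ∀ i j → v i ≡ v j
    all-equal i j = i-j≡0⇒i≡j (v i) (v j)
      (square≡0⇒≡0 _ (∑F.nonneg-∑≡0⇒≡0 _ (λ j → square-nonneg (v i - v j)) (row≡0 i) j))

  Tr-∗σ : ∀ v → Tr (v ∗ σ v) ≡ + p * ∑F (λ i → v i * v i) - ∑F v * ∑F v
  Tr-∗σ v = cong₂ (λ x y → + p * x - y) coeff₀ (trans (∑F-∗ v (σ v)) (cong (∑F v *_) (∑F-⊖ v)))
    where
    coeff₀ : (v ∗ σ v) 𝟘 ≡ ∑F (λ i → v i * v i)
    coeff₀ = ∑-cong (allFin p) (λ i → cong (λ z → v i * v z) (trans (cong ⊖ (⊕-identityˡ (⊖ i))) (⊖-involutive i)))

  D≡2Tr : ∀ v → D v ≡ + 2 * Tr (v ∗ σ v)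
  D≡2Tr v = begin
    ∑F (λ i → ∑F (λ j → (v i - v j) * (v i - v j)))
      ≡⟨ ∑-cong (allFin p) (λ i → ∑-cong (allFin p) (λ j → expand (v i) (v j))) ⟩
    ∑F (λ i → ∑F (λ j → v i * v i + v j * v j - + 2 * v i * v j))  ≡⟨ ∑-cong (allFin p) (λ i → inner i) ⟩
    ∑F (λ i → + p * (v i * v i) + S₂ - + 2 * v i * S₁)            ≡⟨ outer ⟩
    + p * S₂ + + p * S₂ - + 2 * S₁ * S₁                           ≡⟨ collect (+ p) S₂ S₁ ⟩
    + 2 * (+ p * S₂ - S₁ * S₁)                                    ≡⟨ cong (+ 2 *_) (Tr-∗σ v) ⟨
    + 2 * Tr (v ∗ σ v) ∎
    where
    S₁ = ∑F v
    S₂ = ∑F (λ i → v i * v i)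
    expand : ∀ x y → (x - y) * (x - y) ≡ x * x + y * y - + 2 * x * y
    expand = solve-∀
    collect : ∀ q s t → q * s + q * s - + 2 * t * t ≡ + 2 * (q * s - t * t)
    collect = solve-∀
    inner : ∀ i → ∑F (λ j → v i * v i + v j * v j - + 2 * v i * v j) ≡ + p * (v i * v i) + S₂ - + 2 * v i * S₁
    inner i = trans (∑-distrib-- (allFin p) _ _)
      (cong₂ _-_ (trans (∑-distrib-+ (allFin p) _ _) (cong (_+ S₂) (∑F-const _))) (∑-*ˡ (allFin p) (+ 2 * v i) v))
    outer : ∑F (λ i → + p * (v i * v i) + S₂ - + 2 * v i * S₁) ≡ + p * S₂ + + p * S₂ - + 2 * S₁ * S₁
    outer = trans (∑-distrib-- (allFin p) _ _)
      (cong₂ _-_ (trans (∑-distrib-+ (allFin p) _ _) (cong₂ _+_ (∑-*ˡ (allFin p) (+ p) _) (∑F-const S₂)))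
                 (trans (∑-*ʳ (allFin p) S₁ (λ i → + 2 * v i)) (cong (_* S₁) (∑-*ˡ (allFin p) (+ 2) v))))

  module WithPrime (p-prime : Prime p) where

    open Field p-prime

    -- Summing the hypothesis over l gives p c = 0; then a is constant along the
    -- multiples of d, which exhaust GF(p).
    shift-invariant⇒≈0 : ∀ (a : ℤζ) d c → d ≢ 𝟘 → (∀ l → a (l ⊕ d) ≡ a l + c) → a ≈ czero p
    shift-invariant⇒≈0 a d c d≢0 shift = mk≈ (a 𝟘) λ k → trans (constant k) (sym (+-identityˡ (a 𝟘)))
      where
      pc≡0 : + p * c ≡ + p * + 0
      pc≡0 = begin
        + p * c                                  ≡⟨ +-cancelˡ (∑F a) (+ p * c) ⟨
        ∑F a + + p * c - ∑F a                    ≡⟨ cong (λ z → ∑F a + z - ∑F a) (∑F-const c) ⟨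
        ∑F a + ∑F (λ _ → c) - ∑F a               ≡⟨ cong (_- ∑F a) (∑-distrib-+ (allFin p) a (λ _ → c)) ⟨
        ∑F (λ l → a l + c) - ∑F a                ≡⟨ cong (_- ∑F a) (∑-cong (allFin p) (λ l → sym (shift l))) ⟩
        ∑F (λ l → a (l ⊕ d)) - ∑F a              ≡⟨ cong (_- ∑F a) (∑F-⊕ d a) ⟩
        ∑F a - ∑F a                              ≡⟨ +-inverseʳ (∑F a) ⟩
        + 0                                      ≡⟨ *-zeroʳ (+ p) ⟨
        + p * + 0 ∎
        where +-cancelˡ : ∀ x y → x + y - x ≡ y
              +-cancelˡ = solve-∀
      step : ∀ l → a (l ⊕ d) ≡ a l
      step l = trans (shift l) (trans (cong (_+_ (a l)) (*-cancelˡ-≡ (+ p) c (+ 0) pc≡0)) (+-identityʳ (a l)))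
      along-multiples : ∀ t → a (ι t ⊗ d) ≡ a 𝟘
      along-multiples zero = cong a (⊗-zeroˡ d)
      along-multiples (suc t) = begin
        a (ι (suc t) ⊗ d)        ≡⟨ cong (λ z → a (z ⊗ d)) (trans (cong ι (ℕP.+-comm 1 t)) (ι-+ t 1)) ⟩
        a ((ι t ⊕ 𝟙) ⊗ d)
          ≡⟨ cong a (trans (⊗-distribʳ-⊕ d (ι t) 𝟙) (cong (ι t ⊗ d ⊕_) (⊗-identityˡ d))) ⟩
        a (ι t ⊗ d ⊕ d)          ≡⟨ step (ι t ⊗ d) ⟩
        a (ι t ⊗ d)              ≡⟨ along-multiples t ⟩
        a 𝟘 ∎
      constant : ∀ k → a k ≡ a 𝟘
      constant k = trans (cong a (sym k≡multiple)) (along-multiples (toℕ (k ⊗ d⁻¹)))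
        where
        d⁻¹ = proj₁ (inverse d d≢0)
        k≡multiple : ι (toℕ (k ⊗ d⁻¹)) ⊗ d ≡ k
        k≡multiple = begin
          ι (toℕ (k ⊗ d⁻¹)) ⊗ d    ≡⟨ cong (_⊗ d) (ι-toℕ _) ⟩
          k ⊗ d⁻¹ ⊗ d              ≡⟨ ⊗-assoc k d⁻¹ d ⟩
          k ⊗ (d⁻¹ ⊗ d)            ≡⟨ cong (k ⊗_) (trans (⊗-comm d⁻¹ d) (proj₂ (inverse d d≢0))) ⟩
          k ⊗ 𝟙                    ≡⟨ ⊗-identityʳ k ⟩
          k ∎

    ⊝-shifts-≈⇒≈0 : ∀ a {l t} → l ≢ t → (λ k → a (k ⊝ l)) ≈ (λ k → a (k ⊝ t)) → a ≈ czero p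
    ⊝-shifts-≈⇒≈0 a {l} {t} l≢t (mk≈ c h) = shift-invariant⇒≈0 a (l ⊝ t) (- c) l⊝t≢0 shift
      where
      l⊝t≢0 : l ⊝ t ≢ 𝟘
      l⊝t≢0 e = l≢t (trans (sym (⊝-⊕-cancel l t)) (trans (cong (_⊕ t) e) (⊕-identityˡ t)))
      shift : ∀ q → a (q ⊕ (l ⊝ t)) ≡ a q + - c
      shift q = begin
        a (q ⊕ (l ⊝ t))             ≡⟨ cong a (⊕-assoc q l (⊖ t)) ⟨
        a (q ⊕ l ⊝ t)               ≡⟨ +-cancelʳ _ c ⟨
        a (q ⊕ l ⊝ t) + c + - c     ≡⟨ cong (_+ - c) (h (q ⊕ l)) ⟨
        a (q ⊕ l ⊝ l) + - c         ≡⟨ cong (λ z → a z + - c) (⊕-⊝-cancel q l) ⟩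
        a q + - c ∎
        where +-cancelʳ : ∀ x y → x + y + - y ≡ x
              +-cancelʳ = solve-∀

module _ (p : ℕ) {{_ : NonZero p}} (p-prime : Prime p) where

  open GF p
  open Cyclotomic p
  open WithPrime p-prime
  open Vectors p using (module ∑F)

  -- The w_j / N are orthogonal idempotents: v = w_j w_l is real, so N² Tr v = Tr (v v̄) is a
  -- sum of squares and hence ≥ 0, while Σ_{j,l} Tr (w_j w_l) = Tr N² = Σ_j Tr (w_j²) leaves
  -- no room for j ≠ l. Multiplying Σ ζ^j w_j = N ζ^t by w_l then gives ζ^l w_l = ζ^t w_l.
  module OrthogonalIdempotents
    (N : ℤ) {{_ : NonZeroℤ N}} (w : F p → ℤζ) (t : F p)
    (w²≈Nw : ∀ j → w j ∗ w j ≈ N · w j)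
    (σw≈w : ∀ j → σ (w j) ≈ w j)
    (∑w≈N : ∑ᶜ (allFin p) w ≈ N · ζ^ 𝟘)
    (∑ζʲw≈Nζᵗ : ∑ᶜ (allFin p) (λ j → ζ^ j ∗ w j) ≈ N · ζ^ t)
    where

    T : F p → F p → ℤ
    T j l = Tr (w j ∗ w l)

    N·N≗ : (N · ζ^ 𝟘) ∗ (N · ζ^ 𝟘) ≗ (N * N) · ζ^ 𝟘
    N·N≗ k = trans (∗-·ˡ N (ζ^ 𝟘) (N · ζ^ 𝟘) k) (trans (cong (N *_) (∗-unitˡ (N · ζ^ 𝟘) k)) (sym (*-assoc N N _)))

    ∑∑T≡TrN² : ∑F (λ j → ∑F (λ l → T j l)) ≡ Tr ((N * N) · ζ^ 𝟘)
    ∑∑T≡TrN² = begin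
      ∑F (λ j → ∑F (λ l → T j l))
        ≡⟨ ∑-cong (allFin p) (λ j → Tr-∑ᶜ (allFin p) (λ l → w j ∗ w l)) ⟨
      ∑F (λ j → Tr (∑ᶜ (allFin p) (λ l → w j ∗ w l)))               ≡⟨ Tr-∑ᶜ (allFin p) _ ⟨
      Tr (∑ᶜ (allFin p) (λ j → ∑ᶜ (allFin p) (λ l → w j ∗ w l)))     ≡⟨ Tr-cong square ⟩
      Tr ((N * N) · ζ^ 𝟘) ∎
      where
      open ≡-Reasoning
      W = ∑ᶜ (allFin p) w
      square : ∑ᶜ (allFin p) (λ j → ∑ᶜ (allFin p) (λ l → w j ∗ w l)) ≈ (N * N) · ζ^ 𝟘
      square = ≈-trans (≗⇒≈ (λ k → sym (trans (∗-∑ᶜˡ (allFin p) w W k)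
                                               (∑-cong (allFin p) (λ j → ∗-∑ᶜʳ (allFin p) (w j) w k)))))
                       (≈-trans (∗-cong ∑w≈N ∑w≈N) (≗⇒≈ N·N≗))

    ∑T-diagonal≡TrN² : ∑F (λ j → T j j) ≡ Tr ((N * N) · ζ^ 𝟘)
    ∑T-diagonal≡TrN² = trans (sym (Tr-∑ᶜ (allFin p) (λ j → w j ∗ w j))) (Tr-cong ∑w²≈N²)
      where
      open ≈-Reasoning
      ∑w²≈N² : ∑ᶜ (allFin p) (λ j → w j ∗ w j) ≈ (N * N) · ζ^ 𝟘
      ∑w²≈N² = begin
        ∑ᶜ (allFin p) (λ j → w j ∗ w j)     ≈⟨ ∑ᶜ-cong (allFin p) w²≈Nw ⟩
        ∑ᶜ (allFin p) (λ j → N · w j)       ≈⟨ ≗⇒≈ (λ k → ∑-*ˡ (allFin p) N (λ j → w j k)) ⟩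
        N · ∑ᶜ (allFin p) w                 ≈⟨ ·-cong N ∑w≈N ⟩
        N · (N · ζ^ 𝟘)                      ≈⟨ ≗⇒≈ (λ k → sym (*-assoc N N _)) ⟩
        (N * N) · ζ^ 𝟘 ∎

    off : F p → F p → ℤ
    off j l = + 1 - (ζ^ j) l

    ∑∑offT≡0 : ∑F (λ j → ∑F (λ l → off j l * T j l)) ≡ + 0
    ∑∑offT≡0 = begin
      ∑F (λ j → ∑F (λ l → off j l * T j l))                  ≡⟨ ∑-cong (allFin p) (λ j → row j) ⟩
      ∑F (λ j → ∑F (λ l → T j l) - T j j)                    ≡⟨ ∑-distrib-- (allFin p) _ _ ⟩
      ∑F (λ j → ∑F (λ l → T j l)) - ∑F (λ j → T j j)         ≡⟨ cong₂ _-_ ∑∑T≡TrN² ∑T-diagonal≡TrN² ⟩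
      Tr ((N * N) · ζ^ 𝟘) - Tr ((N * N) · ζ^ 𝟘)              ≡⟨ +-inverseʳ (Tr ((N * N) · ζ^ 𝟘)) ⟩
      + 0 ∎
      where
      open ≡-Reasoning
      expand : ∀ e t → (+ 1 - e) * t ≡ t - e * t
      expand = solve-∀
      row : ∀ j → ∑F (λ l → off j l * T j l) ≡ ∑F (λ l → T j l) - T j j
      row j = trans (∑-cong (allFin p) (λ l → expand ((ζ^ j) l) (T j l)))
                    (trans (∑-distrib-- (allFin p) _ _) (cong (_-_ (∑F (λ l → T j l))) (∑F.∑-δ′ j (T j))))

    D-∗≡ : ∀ j l → D (w j ∗ w l) ≡ + 2 * (N * N * T j l)
    D-∗≡ j l = begin
      D v                                  ≡⟨ D≡2Tr v ⟩
      + 2 * Tr (v ∗ σ v)                   ≡⟨ cong (+ 2 *_) (Tr-cong vσv≈N²v) ⟩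
      + 2 * Tr ((N * N) · v)               ≡⟨ cong (+ 2 *_) (Tr-· (N * N) v) ⟩
      + 2 * (N * N * T j l) ∎
      where
      open ≡-Reasoning
      v = w j ∗ w l
      vσv≈N²v : v ∗ σ v ≈ (N * N) · v
      vσv≈N²v = ≈-trans (∗-congʳ v (≈-trans (≗⇒≈ (σ-∗ (w j) (w l))) (∗-cong (σw≈w j) (σw≈w l))))
               (≈-trans (≗⇒≈ (∗-interchange (w j) (w l)))
               (≈-trans (∗-cong (w²≈Nw j) (w²≈Nw l))
                        (≗⇒≈ (λ k → trans (∗-·ˡ N (w j) (N · w l) k)
                                           (trans (cong (N *_) (∗-·ʳ N (w j) (w l) k)) (sym (*-assoc N N _)))))))

    orthogonal : ∀ j l → j ≢ l → w j ∗ w l ≈ czero p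
    orthogonal j l j≢l =
      D≡0⇒≈0 (w j ∗ w l) (trans (sym (*-identityˡ _)) (trans (cong (_* D (w j ∗ w l)) (sym off≡1)) (entries≡0 j l)))
      where
      off-D-nonneg : ∀ j l → + 0 ≤ off j l * D (w j ∗ w l)
      off-D-nonneg j l with j Fin.≟ l
      ... | yes _ = ≤-refl
      ... | no _ = ≤-trans (D-nonneg (w j ∗ w l)) (≤-reflexive (sym (*-identityˡ _)))
      total : ∑F (λ j → ∑F (λ l → off j l * D (w j ∗ w l))) ≡ + 0
      total = begin
        ∑F (λ j → ∑F (λ l → off j l * D (w j ∗ w l)))
          ≡⟨ ∑-cong (allFin p) (λ j → ∑-cong (allFin p) (λ l →
               trans (cong (off j l *_) (D-∗≡ j l)) (regroup (off j l) N (T j l)))) ⟩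
        ∑F (λ j → ∑F (λ l → + 2 * (N * N) * (off j l * T j l)))
          ≡⟨ trans (∑-cong (allFin p) (λ j → ∑-*ˡ (allFin p) (+ 2 * (N * N)) (λ l → off j l * T j l)))
                   (∑-*ˡ (allFin p) (+ 2 * (N * N)) (λ j → ∑F (λ l → off j l * T j l))) ⟩
        + 2 * (N * N) * ∑F (λ j → ∑F (λ l → off j l * T j l))        ≡⟨ cong (+ 2 * (N * N) *_) ∑∑offT≡0 ⟩
        + 2 * (N * N) * + 0                                           ≡⟨ *-zeroʳ (+ 2 * (N * N)) ⟩
        + 0 ∎
        where
        open ≡-Reasoning
        regroup : ∀ o n t → o * (+ 2 * (n * n * t)) ≡ + 2 * (n * n) * (o * t)
        regroup = solve-∀
      entries≡0 : ∀ j l → off j l * D (w j ∗ w l) ≡ + 0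
      entries≡0 j = ∑F.nonneg-∑≡0⇒≡0 _ (off-D-nonneg j)
                      (∑F.nonneg-∑≡0⇒≡0 _ (λ j → ∑-nonneg (allFin p) (off-D-nonneg j)) total j)
      off≡1 : off j l ≡ + 1
      off≡1 = cong (λ b → + 1 - χ b) (⌊⌋-false (j Fin.≟ l) j≢l)

    wˡ-∗-twisted-sum : ∀ l → w l ∗ ∑ᶜ (allFin p) (λ j → ζ^ j ∗ w j) ≈ ζ^ l ∗ (N · w l)
    wˡ-∗-twisted-sum l = begin
      w l ∗ ∑ᶜ (allFin p) (λ j → ζ^ j ∗ w j)
        ≈⟨ ≗⇒≈ (λ k → trans (∗-∑ᶜʳ (allFin p) (w l) (λ j → ζ^ j ∗ w j) k)
                            (∑-cong (allFin p) (λ j → ∗-left-comm (w l) (ζ^ j) (w j) k))) ⟩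
      ∑ᶜ (allFin p) (λ j → ζ^ j ∗ (w l ∗ w j))
        ≈⟨ ∑ᶜ-single _ l (λ j j≢l →
             ≈-trans (∗-congʳ (ζ^ j) (orthogonal l j (λ e → j≢l (sym e)))) (≗⇒≈ (∗-zeroʳ (ζ^ j)))) ⟩
      ζ^ l ∗ (w l ∗ w l)                           ≈⟨ ∗-congʳ (ζ^ l) (w²≈Nw l) ⟩
      ζ^ l ∗ (N · w l) ∎
      where open ≈-Reasoning

    off-support≈0 : ∀ l → l ≢ t → w l ≈ czero p
    off-support≈0 l l≢t = ⊝-shifts-≈⇒≈0 (w l) l≢t (·-cancel N shifts)
      where
      open ≈-Reasoning
      shifts : N · (λ k → w l (k ⊝ l)) ≈ N · (λ k → w l (k ⊝ t))
      shifts = begin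
        N · (λ k → w l (k ⊝ l))                     ≈⟨ ≗⇒≈ (ζ^-∗ l (N · w l)) ⟨
        ζ^ l ∗ (N · w l)                             ≈⟨ wˡ-∗-twisted-sum l ⟨
        w l ∗ ∑ᶜ (allFin p) (λ j → ζ^ j ∗ w j)       ≈⟨ ∗-congʳ (w l) ∑ζʲw≈Nζᵗ ⟩
        w l ∗ (N · ζ^ t)
          ≈⟨ ≗⇒≈ (λ k → trans (∗-·ʳ N (w l) (ζ^ t) k) (cong (N *_) (trans (∗-comm (w l) (ζ^ t) k) (ζ^-∗ t (w l) k)))) ⟩
        N · (λ k → w l (k ⊝ t)) ∎

    support≈N : w t ≈ N · ζ^ 𝟘
    support≈N = ≈-trans (≈-sym (∑ᶜ-single w t off-support≈0)) ∑w≈N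

    w≈N·δ : ∀ j → w j ≈ (N * (ζ^ j) t) · ζ^ 𝟘
    w≈N·δ j with j Fin.≟ t
    ... | yes refl = ≈-trans support≈N (≗⇒≈ (λ k → cong (_* (ζ^ 𝟘) k) (sym (*-identityʳ N))))
    ... | no j≢t = ≈-trans (off-support≈0 j j≢t) (≗⇒≈ (λ k → sym (cong (_* (ζ^ 𝟘) k) (*-zeroʳ N))))

module CharacterSums (p : ℕ) {{_ : NonZero p}} (p-prime : Prime p) (n : ℕ) where

  open GF p
  open Field p-prime
  open Vectors p
  open Cyclotomic p
  open WithPrime p-prime

  V : Set
  V = Pt p n

  ∑V : (V → ℤ) → ℤ
  ∑V = ∑ (allPts p n)

  module ∑V = ∑Pt n

  δ₀ : V → ℤ
  δ₀ y = χ (veq p y 0ᵥ)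

  ζ⁻⟨_,_⟩ : V → V → ℤζ
  ζ⁻⟨ x , y ⟩ = ζ^ (⊖ ⟨ x , y ⟩)

  ζ⁻⟨0,_⟩ : ∀ y → ζ⁻⟨ 0ᵥ , y ⟩ ≗ ζ^ 𝟘
  ζ⁻⟨0,_⟩ y k = cong (λ a → (ζ^ a) k) (trans (cong ⊖ (⟨⟩-0ᵥˡ y)) ⊖-𝟘)

  ζ⁻⟨_,0⟩ : ∀ x → ζ⁻⟨ x , 0ᵥ ⟩ ≗ ζ^ 𝟘
  ζ⁻⟨_,0⟩ x k = cong (λ a → (ζ^ a) k) (trans (cong ⊖ (⟨⟩-0ᵥʳ x)) ⊖-𝟘)

  𝓕 : (V → ℤ) → V → ℤζ
  𝓕 g x k = ∑V (λ y → ζ⁻⟨ x , y ⟩ k * g y)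

  S : V → ℤζ
  S x k = ∑V (λ y → ζ⁻⟨ x , y ⟩ k)

  fourier≗𝓕 : ∀ g x → fourier p g x ≗ 𝓕 g x
  fourier≗𝓕 g x k =
    trans (csum≗∑ᶜ (allPts p n) _ k) (∑-cong (allPts p n) (λ y → trans (mono≗· _ (g y) k) (*-comm (g y) _)))

  _⋆_ : (V → ℤ) → (V → ℤ) → V → ℤ
  (g ⋆ h) w = ∑V (λ y → g (w -ᵥ y) * h y)

  S-0ᵥ : S 0ᵥ ≗ + (p ^ℕ n) · ζ^ 𝟘
  S-0ᵥ k = begin
    ∑V (λ y → ζ⁻⟨ 0ᵥ , y ⟩ k)
      ≡⟨ ∑-cong (allPts p n) (λ y → trans (ζ⁻⟨0, y ⟩ k) (sym (*-identityˡ _))) ⟩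
    ∑V (λ _ → + 1 * (ζ^ 𝟘) k)        ≡⟨ ∑-*ʳ (allPts p n) ((ζ^ 𝟘) k) (λ _ → + 1) ⟩
    ∑V (λ _ → + 1) * (ζ^ 𝟘) k        ≡⟨ cong (_* (ζ^ 𝟘) k) (∑-allPts-one n) ⟩
    + (p ^ℕ n) * (ζ^ 𝟘) k ∎
    where open ≡-Reasoning

  -- Translating y by a vector e with ⟨x,e⟩ = 1 multiplies S x by ζ⁻¹.
  S≈0 : ∀ x → x ≢ 0ᵥ → S x ≈ czero p
  S≈0 x x≢0 = shift-invariant⇒≈0 (S x) 𝟙 (+ 0) 𝟙≢𝟘 shift
    where
    open ≡-Reasoning
    e = proj₁ (∃-⟨⟩≡𝟙 p-prime x x≢0)
    ⟨x,y+e⟩ : ∀ y → ⊖ ⟨ x , y +ᵥ e ⟩ ≡ ⊖ ⟨ x , y ⟩ ⊝ 𝟙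
    ⟨x,y+e⟩ y = trans (cong ⊖ (⟨⟩-+ᵥʳ x y e))
                      (trans (⊖-distrib-⊕ ⟨ x , y ⟩ ⟨ x , e ⟩) (cong (λ z → ⊖ ⟨ x , y ⟩ ⊕ ⊖ z) (proj₂ (∃-⟨⟩≡𝟙 p-prime x x≢0))))
    shift : ∀ l → S x (l ⊕ 𝟙) ≡ S x l + + 0
    shift l = begin
      ∑V (λ y → ζ⁻⟨ x , y ⟩ (l ⊕ 𝟙))              ≡⟨ ∑-cong (allPts p n) (λ y → ζ^-⊕ _ 𝟙 l) ⟩
      ∑V (λ y → (ζ^ (⊖ ⟨ x , y ⟩ ⊝ 𝟙)) l)
        ≡⟨ ∑-cong (allPts p n) (λ y → cong (λ a → (ζ^ a) l) (⟨x,y+e⟩ y)) ⟨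
      ∑V (λ y → ζ⁻⟨ x , y +ᵥ e ⟩ l)
        ≡⟨ ∑V.∑-reindex (_+ᵥ e) (_-ᵥ e) (λ y → +ᵥ--ᵥ-cancel y e) (λ y → -ᵥ-+ᵥ-cancel y e) (λ y → ζ⁻⟨ x , y ⟩ l) ⟩
      S x l                                        ≡⟨ +-identityʳ _ ⟨
      S x l + + 0 ∎

  S≈p^n·δ₀ : ∀ w → S w ≈ (+ (p ^ℕ n) * δ₀ w) · ζ^ 𝟘
  S≈p^n·δ₀ w with w ≟ᵥ 0ᵥ
  ... | yes refl = ≗⇒≈ (λ k → trans (S-0ᵥ k) (cong (_* (ζ^ 𝟘) k) (sym (*-identityʳ (+ (p ^ℕ n))))))
  ... | no w≢0 = ≈-trans (S≈0 w w≢0) (≗⇒≈ (λ k → sym (cong (_* (ζ^ 𝟘) k) (*-zeroʳ (+ (p ^ℕ n))))))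

  ζ⁻⟨⟩-∗ : ∀ x y z → ζ⁻⟨ x , y ⟩ ∗ ζ⁻⟨ x , z ⟩ ≗ ζ⁻⟨ x , y +ᵥ z ⟩
  ζ⁻⟨⟩-∗ x y z k = trans (ζ^-∗ (⊖ ⟨ x , y ⟩) ζ⁻⟨ x , z ⟩ k) (trans (ζ^-⊝ (⊖ ⟨ x , z ⟩) (⊖ ⟨ x , y ⟩) k) (cong (λ a → (ζ^ a) k)
    (sym (trans (cong ⊖ (⟨⟩-+ᵥʳ x y z)) (trans (⊖-distrib-⊕ ⟨ x , y ⟩ ⟨ x , z ⟩) (⊕-comm (⊖ ⟨ x , y ⟩) (⊖ ⟨ x , z ⟩)))))))

  𝓕-⋆ : ∀ g h x → 𝓕 g x ∗ 𝓕 h x ≗ 𝓕 (g ⋆ h) x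
  𝓕-⋆ g h x k = begin
    ∑F (λ i → ∑V (λ y → c y i * g y) * ∑V (λ z → c z (k ⊝ i) * h z))
      ≡⟨ ∑-cong (allFin p) (λ i → expand-product i) ⟩
    ∑F (λ i → ∑V (λ y → ∑V (λ z → (g y * h z) * (c y i * c z (k ⊝ i)))))
      ≡⟨ ∑-comm (allFin p) (allPts p n) (λ i y → ∑V (λ z → (g y * h z) * (c y i * c z (k ⊝ i)))) ⟩
    ∑V (λ y → ∑F (λ i → ∑V (λ z → (g y * h z) * (c y i * c z (k ⊝ i)))))
      ≡⟨ ∑-cong (allPts p n) (λ y → ∑-comm (allFin p) (allPts p n) (λ i z → (g y * h z) * (c y i * c z (k ⊝ i)))) ⟩
    ∑V (λ y → ∑V (λ z → ∑F (λ i → (g y * h z) * (c y i * c z (k ⊝ i)))))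
      ≡⟨ ∑-cong (allPts p n) (λ y → ∑-cong (allPts p n) (λ z →
           trans (∑-*ˡ (allFin p) (g y * h z) (λ i → c y i * c z (k ⊝ i))) (cong (g y * h z *_) (ζ⁻⟨⟩-∗ x y z k)))) ⟩
    ∑V (λ y → ∑V (λ z → (g y * h z) * ζ⁻⟨ x , y +ᵥ z ⟩ k))
      ≡⟨ ∑-comm (allPts p n) (allPts p n) (λ y z → (g y * h z) * ζ⁻⟨ x , y +ᵥ z ⟩ k) ⟩
    ∑V (λ z → ∑V (λ y → (g y * h z) * ζ⁻⟨ x , y +ᵥ z ⟩ k))
      ≡⟨ ∑-cong (allPts p n) (λ z → ∑V.∑-reindex (_-ᵥ z) (_+ᵥ z) (λ w → -ᵥ-+ᵥ-cancel w z) (λ y → +ᵥ--ᵥ-cancel y z)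
                                                (λ y → (g y * h z) * ζ⁻⟨ x , y +ᵥ z ⟩ k)) ⟨
    ∑V (λ z → ∑V (λ w → (g (w -ᵥ z) * h z) * ζ⁻⟨ x , w -ᵥ z +ᵥ z ⟩ k))
      ≡⟨ ∑-cong (allPts p n) (λ z → ∑-cong (allPts p n) (λ w →
           cong (λ u → (g (w -ᵥ z) * h z) * ζ⁻⟨ x , u ⟩ k) (-ᵥ-+ᵥ-cancel w z))) ⟩
    ∑V (λ z → ∑V (λ w → (g (w -ᵥ z) * h z) * ζ⁻⟨ x , w ⟩ k))
      ≡⟨ ∑-comm (allPts p n) (allPts p n) (λ z w → (g (w -ᵥ z) * h z) * ζ⁻⟨ x , w ⟩ k) ⟩
    ∑V (λ w → ∑V (λ z → (g (w -ᵥ z) * h z) * ζ⁻⟨ x , w ⟩ k))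
      ≡⟨ ∑-cong (allPts p n) (λ w →
           trans (∑-*ʳ (allPts p n) (ζ⁻⟨ x , w ⟩ k) (λ z → g (w -ᵥ z) * h z)) (*-comm ((g ⋆ h) w) (ζ⁻⟨ x , w ⟩ k))) ⟩
    ∑V (λ w → ζ⁻⟨ x , w ⟩ k * (g ⋆ h) w) ∎
    where
    open ≡-Reasoning
    c : V → F p → ℤ
    c y = ζ⁻⟨ x , y ⟩
    expand-product : ∀ i → ∑V (λ y → c y i * g y) * ∑V (λ z → c z (k ⊝ i) * h z) ≡
                           ∑V (λ y → ∑V (λ z → (g y * h z) * (c y i * c z (k ⊝ i))))
    expand-product i = trans (sym (∑-*ʳ (allPts p n) (∑V (λ z → c z (k ⊝ i) * h z)) (λ y → c y i * g y)))
      (∑-cong (allPts p n) (λ y → trans (sym (∑-*ˡ (allPts p n) (c y i * g y) (λ z → c z (k ⊝ i) * h z)))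
        (∑-cong (allPts p n) (λ z → rearrange (c y i) (g y) (c z (k ⊝ i)) (h z)))))
      where rearrange : ∀ u v w z → (u * v) * (w * z) ≡ (v * z) * (u * w)
            rearrange = solve-∀

  𝓕-affine : ∀ a b c g x → 𝓕 (λ w → a * δ₀ w + b * g w + c) x ≗ a · ζ^ 𝟘 +ᶜ b · 𝓕 g x +ᶜ c · S x
  𝓕-affine a b c g x k = begin
    ∑V (λ w → ζ⁻⟨ x , w ⟩ k * (a * δ₀ w + b * g w + c))
      ≡⟨ ∑-cong (allPts p n) (λ w → distribute (ζ⁻⟨ x , w ⟩ k) a (δ₀ w) b (g w) c) ⟩
    ∑V (λ w → a * (δ₀ w * ζ⁻⟨ x , w ⟩ k) + b * (ζ⁻⟨ x , w ⟩ k * g w) + c * ζ⁻⟨ x , w ⟩ k)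
      ≡⟨ trans (∑-distrib-+ (allPts p n) _ _) (cong₂ _+_ (trans (∑-distrib-+ (allPts p n) _ _)
           (cong₂ _+_ (∑-*ˡ (allPts p n) a _) (∑-*ˡ (allPts p n) b _))) (∑-*ˡ (allPts p n) c _)) ⟩
    a * ∑V (λ w → δ₀ w * ζ⁻⟨ x , w ⟩ k) + b * 𝓕 g x k + c * S x k
      ≡⟨ cong (λ z → a * z + b * 𝓕 g x k + c * S x k) (trans (∑V.∑-δ 0ᵥ (λ w → ζ⁻⟨ x , w ⟩ k)) (ζ⁻⟨_,0⟩ x k)) ⟩
    a * (ζ^ 𝟘) k + b * 𝓕 g x k + c * S x k ∎
    where
    open ≡-Reasoning
    distribute : ∀ e a d b q c → e * (a * d + b * q + c) ≡ a * (d * e) + b * (e * q) + c * e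
    distribute = solve-∀

  -- Σ_y a(y) ζ^{⟨x,y⟩}: shifting coefficients by ⟨x,y⟩ multiplies by ζ^{⟨x,y⟩}.
  𝓕⁻ : (V → ℤζ) → V → ℤζ
  𝓕⁻ a x k = ∑V (λ y → a y (k ⊕ ⟨ x , y ⟩))

  𝓕⁻-cong : ∀ {a b} x → (∀ y → a y ≈ b y) → 𝓕⁻ a x ≈ 𝓕⁻ b x
  𝓕⁻-cong x a≈b = ∑ᶜ-cong (allPts p n) (λ y → ⊕-cong ⟨ x , y ⟩ (a≈b y))

  𝓕⁻-scalar : ∀ φ x → 𝓕⁻ (λ y → φ y · ζ^ 𝟘) x ≗ 𝓕 φ x
  𝓕⁻-scalar φ x k = ∑-cong (allPts p n) (λ y →
    trans (cong (φ y *_) (trans (ζ^-⊕ 𝟘 ⟨ x , y ⟩ k) (cong (λ a → (ζ^ a) k) (⊕-identityˡ _)))) (*-comm (φ y) _))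

  𝓕⁻𝓕≗∑S : ∀ g x → 𝓕⁻ (𝓕 g) x ≗ ∑ᶜ (allPts p n) (λ z → g z · S (x +ᵥ z))
  𝓕⁻𝓕≗∑S g x k = begin
    ∑V (λ y → ∑V (λ z → ζ⁻⟨ y , z ⟩ (k ⊕ ⟨ x , y ⟩) * g z))
      ≡⟨ ∑-cong (allPts p n) (λ y → ∑-cong (allPts p n) (λ z →
           trans (cong (_* g z) (trans (ζ^-⊕ _ ⟨ x , y ⟩ k) (cong (λ a → (ζ^ a) k) (exponent y z)))) (*-comm _ (g z)))) ⟩
    ∑V (λ y → ∑V (λ z → g z * ζ⁻⟨ x +ᵥ z , y ⟩ k))
      ≡⟨ ∑-comm (allPts p n) (allPts p n) (λ y z → g z * ζ⁻⟨ x +ᵥ z , y ⟩ k) ⟩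
    ∑V (λ z → ∑V (λ y → g z * ζ⁻⟨ x +ᵥ z , y ⟩ k))
      ≡⟨ ∑-cong (allPts p n) (λ z → ∑-*ˡ (allPts p n) (g z) (λ y → ζ⁻⟨ x +ᵥ z , y ⟩ k)) ⟩
    ∑V (λ z → g z * S (x +ᵥ z) k) ∎
    where
    open ≡-Reasoning
    exponent : ∀ y z → ⊖ ⟨ y , z ⟩ ⊝ ⟨ x , y ⟩ ≡ ⊖ ⟨ x +ᵥ z , y ⟩
    exponent y z = begin
      ⊖ ⟨ y , z ⟩ ⊕ ⊖ ⟨ x , y ⟩         ≡⟨ ⊖-distrib-⊕ ⟨ y , z ⟩ ⟨ x , y ⟩ ⟨
      ⊖ (⟨ y , z ⟩ ⊕ ⟨ x , y ⟩)
        ≡⟨ cong ⊖ (trans (⊕-comm ⟨ y , z ⟩ ⟨ x , y ⟩) (cong (⟨ x , y ⟩ ⊕_) (⟨⟩-comm y z))) ⟩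
      ⊖ (⟨ x , y ⟩ ⊕ ⟨ z , y ⟩)         ≡⟨ cong ⊖ (⟨⟩-+ᵥˡ x z y) ⟨
      ⊖ ⟨ x +ᵥ z , y ⟩ ∎

  𝓕⁻𝓕 : ∀ g x → 𝓕⁻ (𝓕 g) x ≈ (+ (p ^ℕ n) * g (-ᵥ x)) · ζ^ 𝟘
  𝓕⁻𝓕 g x = ≈-trans (≗⇒≈ (𝓕⁻𝓕≗∑S g x)) (≈-trans (∑ᶜ-cong (allPts p n) (λ z → ·-cong (g z) (S≈p^n·δ₀ (x +ᵥ z)))) (≗⇒≈ pick))
    where
    open ≡-Reasoning
    δ₀-+ᵥ : ∀ z → δ₀ (x +ᵥ z) ≡ χ ⌊ z ≟ᵥ (-ᵥ x) ⌋
    δ₀-+ᵥ z = cong χ (⌊⌋-⇔ (mk⇔ (+ᵥ≡0ᵥ⇒≡-ᵥ x z) (λ e → trans (cong (x +ᵥ_) e) (+ᵥ-inverseʳ x)))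
                           (x +ᵥ z ≟ᵥ 0ᵥ) (z ≟ᵥ (-ᵥ x)))
    pick : ∑ᶜ (allPts p n) (λ z → g z · ((+ (p ^ℕ n) * δ₀ (x +ᵥ z)) · ζ^ 𝟘)) ≗ (+ (p ^ℕ n) * g (-ᵥ x)) · ζ^ 𝟘
    pick k = begin
      ∑V (λ z → g z * (pⁿ * δ₀ (x +ᵥ z) * e))
        ≡⟨ ∑-cong (allPts p n) (λ z → trans (regroup (g z) pⁿ (δ₀ (x +ᵥ z)) e) (cong (λ d → pⁿ * e * (d * g z)) (δ₀-+ᵥ z))) ⟩
      ∑V (λ z → pⁿ * e * (χ ⌊ z ≟ᵥ (-ᵥ x) ⌋ * g z))          ≡⟨ ∑-*ˡ (allPts p n) (pⁿ * e) _ ⟩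
      pⁿ * e * ∑V (λ z → χ ⌊ z ≟ᵥ (-ᵥ x) ⌋ * g z)            ≡⟨ cong (pⁿ * e *_) (∑V.∑-δ (-ᵥ x) g) ⟩
      pⁿ * e * g (-ᵥ x)                                      ≡⟨ swap pⁿ e (g (-ᵥ x)) ⟩
      pⁿ * g (-ᵥ x) * e ∎
      where
      pⁿ = + (p ^ℕ n)
      e = (ζ^ 𝟘) k
      regroup : ∀ g a d e → g * (a * d * e) ≡ a * e * (d * g)
      regroup = solve-∀
      swap : ∀ a e g → a * e * g ≡ a * g * e
      swap = solve-∀

module LevelSets (p : ℕ) {{_ : NonZero p}} (n : ℕ) (h : Pt p n → F p) where

  open GF p
  open Vectors p
  open Cyclotomic p

  isP : ℕ → Bool
  isP i = ⌊ i ℕ.≟ p ⌋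

  χ-isP-ζ^𝟘 : ∀ i → χ (isP i) * (ζ^ 𝟘) (ι i) ≡ χ (isP i)
  χ-isP-ζ^𝟘 i with i ℕ.≟ p
  ... | yes refl = trans (*-identityˡ _) (trans (cong (ζ^ 𝟘) ι-p) (ζ^-diag 𝟘))
  ... | no _ = refl

  χ-inD : ∀ i → i ≤ℕ p → ∀ y → χ (inD p h i y) ≡ (ζ^ (h y)) (ι i) * (+ 1 - χ (isP i) * χ (veq p y 0ᵥ))
  χ-inD i i≤p y with i ℕ.≟ p
  ... | yes refl = trans (χ-∧ (feq p (h y) 𝟘) _)
                         (cong₂ _*_ (cong (ζ^ (h y)) (sym ι-p)) (χ-not-∧ true (veq p y 0ᵥ)))
  ... | no i≢p = trans (cong χ (⌊⌋-⇔ (mk⇔ (λ e → trans (sym (ι-toℕ (h y))) (cong ι e))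
                                           (λ e → trans (cong toℕ e) (ι-< i<p)))
                                      (toℕ (h y) ℕ.≟ i) (h y Fin.≟ ι i)))
                       (sym (*-identityʳ _))
    where i<p = ℕP.≤∧≢⇒< i≤p i≢p

  χ-inD-≢0ᵥ : ∀ i → i ≤ℕ p → ∀ y → y ≢ 0ᵥ → χ (inD p h i y) ≡ (ζ^ (h y)) (ι i)
  χ-inD-≢0ᵥ i i≤p y y≢0 = trans (χ-inD i i≤p y)
    (trans (cong (λ b → (ζ^ (h y)) (ι i) * (+ 1 - χ (isP i) * χ b)) (⌊⌋-false (y ≟ᵥ 0ᵥ) y≢0))
           (trans (cong (λ z → (ζ^ (h y)) (ι i) * (+ 1 - z)) (*-zeroʳ (χ (isP i)))) (*-identityʳ _)))

  inD-0ᵥ : h 0ᵥ ≡ 𝟘 → ∀ i → 1 ≤ℕ i → inD p h i 0ᵥ ≡ false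
  inD-0ᵥ h0≡0 i 1≤i with i ℕ.≟ p
  ... | yes _ = trans (cong (λ b → feq p (h 0ᵥ) 𝟘 ∧ not b) (⌊⌋-true (0ᵥ ≟ᵥ 0ᵥ) refl)) (∧-zeroʳ _)
  ... | no _ = ⌊⌋-false (toℕ (h 0ᵥ) ℕ.≟ i) (λ e → ℕP.<⇒≢ 1≤i (trans (sym (trans (cong toℕ h0≡0) toℕ-𝟘)) e))

  inD-neg : (∀ y → h (-ᵥ y) ≡ h y) → ∀ i y → inD p h i (-ᵥ y) ≡ inD p h i y
  inD-neg even i y = cong₂ (λ a b → if isP i then feq p a 𝟘 ∧ not b else ⌊ toℕ a ℕ.≟ i ⌋) (even y) veq-neg
    where
    veq-neg : veq p (-ᵥ y) 0ᵥ ≡ veq p y 0ᵥ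
    veq-neg = ⌊⌋-⇔ (mk⇔ (-ᵥ≡0ᵥ⇒≡0ᵥ y) (λ e → trans (cong -ᵥ_ e) -ᵥ0ᵥ)) ((-ᵥ y) ≟ᵥ 0ᵥ) (y ≟ᵥ 0ᵥ)

module CayleyGraph (p : ℕ) {{_ : NonZero p}} (p-prime : Prime p) (n : ℕ) (P : Pt p n → Bool)
  (P-0ᵥ : P (Vectors.0ᵥ p) ≡ false) (P-neg : ∀ y → P (Vectors.-ᵥ_ p y) ≡ P y) where

  open Vectors p
  open CharacterSums p p-prime n

  adj : V → V → Bool
  adj x y = not (veq p x y) ∧ P (x -ᵥ y)

  g : V → ℤ
  g y = χ (P y)

  adj≡P : ∀ x y → adj x y ≡ P (x -ᵥ y)
  adj≡P x y with P (x -ᵥ y) in Pxy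
  ... | false = ∧-zeroʳ _
  ... | true = cong (λ b → not b ∧ true) (⌊⌋-false (x ≟ᵥ y) x≢y)
    where
    x≢y : x ≢ y
    x≢y refl = case trans (sym Pxy) (trans (cong P (x-ᵥx x)) P-0ᵥ) of λ ()

  adj-0ᵥ : ∀ z → adj 0ᵥ z ≡ P z
  adj-0ᵥ z = trans (adj≡P 0ᵥ z) (trans (cong P (0ᵥ-ᵥ z)) (P-neg z))

  adj-to-0ᵥ : ∀ w → adj w 0ᵥ ≡ P w
  adj-to-0ᵥ w = trans (adj≡P w 0ᵥ) (cong P (x-ᵥ0ᵥ w))

  common≡⋆ : ∀ w → + count (λ z → adj w z ∧ adj 0ᵥ z) (allPts p n) ≡ (g ⋆ g) w
  common≡⋆ w = trans (count≡∑χ _ (allPts p n)) (∑-cong (allPts p n) (λ z →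
    trans (χ-∧ (adj w z) (adj 0ᵥ z)) (cong₂ (λ a b → χ a * χ b) (adj≡P w z) (adj-0ᵥ z))))

  module _ {ν k λ′ μ : ℤ} (srg : IsSRG (allPts p n) adj ν k λ′ μ) where

    degree : ∑V g ≡ k
    degree = trans (sym (trans (count≡∑χ (adj 0ᵥ) (allPts p n)) (∑-cong (allPts p n) (λ z → cong χ (adj-0ᵥ z)))))
                   (proj₁ (proj₂ srg) 0ᵥ)

    autocorrelation : ∀ w → (g ⋆ g) w ≡ (k - μ) * δ₀ w + (λ′ - μ) * g w + μ
    autocorrelation w with w ≟ᵥ 0ᵥ
    ... | yes refl = begin
      (g ⋆ g) 0ᵥ                                        ≡⟨ common≡⋆ 0ᵥ ⟨
      + count (λ z → adj 0ᵥ z ∧ adj 0ᵥ z) (allPts p n)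
        ≡⟨ trans (count≡∑χ _ (allPts p n))
                 (trans (∑-cong (allPts p n) (λ z → cong χ (∧-idem (adj 0ᵥ z)))) (sym (count≡∑χ _ (allPts p n)))) ⟩
      + count (adj 0ᵥ) (allPts p n)                     ≡⟨ proj₁ (proj₂ srg) 0ᵥ ⟩
      k                                                 ≡⟨ at-0ᵥ k μ (λ′ - μ) ⟨
      (k - μ) * + 1 + (λ′ - μ) * + 0 + μ
        ≡⟨ cong (λ b → (k - μ) * + 1 + (λ′ - μ) * χ b + μ) P-0ᵥ ⟨
      (k - μ) * + 1 + (λ′ - μ) * g 0ᵥ + μ ∎
      where open ≡-Reasoning
            at-0ᵥ : ∀ a b c → (a - b) * + 1 + c * + 0 + b ≡ a
            at-0ᵥ = solve-∀
    ... | no w≢0 with P w in Pw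
    ...   | true = begin
      (g ⋆ g) w                                         ≡⟨ common≡⋆ w ⟨
      + count (λ z → adj w z ∧ adj 0ᵥ z) (allPts p n)
        ≡⟨ proj₁ (proj₂ (proj₂ srg)) w 0ᵥ (trans (adj-to-0ᵥ w) Pw) ⟩
      λ′                                                ≡⟨ adjacent k μ λ′ ⟨
      (k - μ) * + 0 + (λ′ - μ) * + 1 + μ ∎
      where open ≡-Reasoning
            adjacent : ∀ a b c → (a - b) * + 0 + (c - b) * + 1 + b ≡ c
            adjacent = solve-∀
    ...   | false = begin
      (g ⋆ g) w                                         ≡⟨ common≡⋆ w ⟨
      + count (λ z → adj w z ∧ adj 0ᵥ z) (allPts p n)
        ≡⟨ proj₂ (proj₂ (proj₂ srg)) w 0ᵥ w≢0 (trans (adj-to-0ᵥ w) Pw) ⟩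
      μ                                                 ≡⟨ non-adjacent k μ λ′ ⟨
      (k - μ) * + 0 + (λ′ - μ) * + 0 + μ ∎
      where open ≡-Reasoning
            non-adjacent : ∀ a b c → (a - b) * + 0 + (c - b) * + 0 + b ≡ b
            non-adjacent = solve-∀

module Feasible (p : ℕ) {{_ : NonZero p}} (p-prime : Prime p) (m : ℕ) (m≥1 : 1 ≤ℕ m) (s : LSType)
  (f : Pt p (2 *ℕ m) → F p) (feasible : IsFeasible p m s f) where

  open GF p
  open Field p-prime
  open Vectors p
  open Cyclotomic p
  open WithPrime p-prime
  open CharacterSums p p-prime (2 *ℕ m)
  open LevelSets p (2 *ℕ m) f

  f-even : ∀ y → f (-ᵥ y) ≡ f y
  f-even = proj₁ feasible

  f-0ᵥ : f 0ᵥ ≡ 𝟘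
  f-0ᵥ = proj₁ (proj₂ feasible)

  N M : ℤ
  N = NN p m s
  M = sgn s * + (p ^ℕ (m ∸ 1))

  r k λ′ μ : ℕ → ℤ
  r = rr p m s
  k i = (N - + 1) * r i
  λ′ i = N + r i * r i - + 3 * r i
  μ i = r i * r i - r i

  sgn²≡1 : ∀ s → sgn s * sgn s ≡ + 1
  sgn²≡1 latin = refl
  sgn²≡1 negLatin = refl

  N²≡p^2m : N * N ≡ + (p ^ℕ (2 *ℕ m))
  N²≡p^2m = begin
    sgn s * pᵐ * (sgn s * pᵐ)              ≡⟨ interchange (sgn s) pᵐ ⟩
    sgn s * sgn s * (pᵐ * pᵐ)              ≡⟨ cong (_* (pᵐ * pᵐ)) (sgn²≡1 s) ⟩
    + 1 * (pᵐ * pᵐ)                        ≡⟨ *-identityˡ _ ⟩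
    pᵐ * pᵐ                                ≡⟨ pos-* (p ^ℕ m) (p ^ℕ m) ⟨
    + (p ^ℕ m *ℕ p ^ℕ m)                   ≡⟨ cong +_ (ℕP.^-distribˡ-+-* p m m) ⟨
    + (p ^ℕ (m +ℕ m))                      ≡⟨ cong (λ e → + (p ^ℕ (m +ℕ e))) (ℕP.+-identityʳ m) ⟨
    + (p ^ℕ (2 *ℕ m)) ∎
    where
    open ≡-Reasoning
    pᵐ = + (p ^ℕ m)
    interchange : ∀ a b → a * b * (a * b) ≡ a * a * (b * b)
    interchange = solve-∀

  N≢0 : N ≢ + 0
  N≢0 N≡0 = ℕ.≢-nonZero⁻¹ (p ^ℕ (2 *ℕ m)) {{ℕP.m^n≢0 p (2 *ℕ m)}} (+-injective (trans (sym N²≡p^2m) (cong (_* N) N≡0)))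

  instance
    N-nonZero : NonZeroℤ N
    N-nonZero = ≢-nonZero N≢0

  p·M≡N : + p * M ≡ N
  p·M≡N = trans (*-left-comm (+ p) (sgn s) _) (cong (sgn s *_) (trans (sym (pos-* p _)) (cong +_ (p^[1+m∸1] m m≥1))))
    where
    *-left-comm : ∀ a b c → a * (b * c) ≡ b * (a * c)
    *-left-comm = solve-∀
    p^[1+m∸1] : ∀ m → 1 ≤ℕ m → p *ℕ p ^ℕ (m ∸ 1) ≡ p ^ℕ m
    p^[1+m∸1] (suc _) _ = refl

  module Γ (i : ℕ) (1≤i : 1 ≤ℕ i) = CayleyGraph p p-prime (2 *ℕ m) (inD p f i) (inD-0ᵥ f-0ᵥ i 1≤i) (inD-neg f-even i)

  srg : ∀ i (1≤i : 1 ≤ℕ i) → i ≤ℕ p → IsSRG (allPts p (2 *ℕ m)) (Γ.adj i 1≤i) (N * N) (k i) (λ′ i) (μ i)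
  srg = proj₂ (proj₂ feasible)

  𝓕fᵢ² : ∀ i → 1 ≤ℕ i → i ≤ℕ p → ∀ x →
         𝓕 (indic p f i) x ∗ 𝓕 (indic p f i) x ≗ (k i - μ i) · ζ^ 𝟘 +ᶜ (λ′ i - μ i) · 𝓕 (indic p f i) x +ᶜ μ i · S x
  𝓕fᵢ² i 1≤i i≤p x q = trans (𝓕-⋆ fᵢ fᵢ x q) (trans
    (∑-cong (allPts p (2 *ℕ m)) (λ w → cong (ζ⁻⟨ x , w ⟩ q *_) (Γ.autocorrelation i 1≤i (srg i 1≤i i≤p) w)))
    (𝓕-affine (k i - μ i) (λ′ i - μ i) (μ i) fᵢ x q))
    where fᵢ = indic p f i

  𝓕fᵢ+r-idempotent : ∀ i → 1 ≤ℕ i → i ≤ℕ p → ∀ x → x ≢ 0ᵥ →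
    (𝓕 (indic p f i) x +ᶜ r i · ζ^ 𝟘) ∗ (𝓕 (indic p f i) x +ᶜ r i · ζ^ 𝟘) ≈ N · (𝓕 (indic p f i) x +ᶜ r i · ζ^ 𝟘)
  𝓕fᵢ+r-idempotent i 1≤i i≤p x x≢0 = latin-square-idempotent (𝓕 (indic p f i) x) N (r i)
    (≈-trans (≗⇒≈ (𝓕fᵢ² i 1≤i i≤p x)) (≈0⇒+ᶜ≈ _ (≈-trans (·-cong (μ i) (S≈0 x x≢0)) (≗⇒≈ (λ _ → *-zeroʳ (μ i))))))

  -- For x ≠ 0 the u j x turn out to be N times orthogonal idempotents (M = N / p).
  G : F p → V → ℤζ
  G j = 𝓕 (λ y → (ζ^ (f y)) j)

  u : F p → V → ℤζ
  u j x = G j x +ᶜ M · ζ^ 𝟘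

  𝓕fᵢ≗G : ∀ i → i ≤ℕ p → ∀ x → 𝓕 (indic p f i) x +ᶜ χ (isP i) · ζ^ 𝟘 ≗ G (ι i) x
  𝓕fᵢ≗G i i≤p x q = begin
    𝓕 (indic p f i) x q + c * e
      ≡⟨ cong (_+ c * e) (∑-cong (allPts p (2 *ℕ m)) (λ y →
           trans (cong (E y *_) (χ-inD i i≤p y)) (expand (E y) (L y) c (δ₀ y)))) ⟩
    ∑V (λ y → E y * L y - c * (δ₀ y * (E y * L y))) + c * e
      ≡⟨ cong (_+ c * e) (trans (∑-distrib-- (allPts p (2 *ℕ m)) _ _) (cong (_-_ (G (ι i) x q))
           (trans (∑-*ˡ (allPts p (2 *ℕ m)) c _) (cong (c *_) (∑V.∑-δ 0ᵥ (λ y → E y * L y)))))) ⟩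
    G (ι i) x q - c * (E 0ᵥ * L 0ᵥ) + c * e
      ≡⟨ cong (λ z → G (ι i) x q - z + c * e) at-0ᵥ ⟩
    G (ι i) x q - c * e + c * e
      ≡⟨ cancel (G (ι i) x q) (c * e) ⟩
    G (ι i) x q ∎
    where
    open ≡-Reasoning
    c = χ (isP i)
    e = (ζ^ 𝟘) q
    E : V → ℤ
    E y = ζ⁻⟨ x , y ⟩ q
    L : V → ℤ
    L y = (ζ^ (f y)) (ι i)
    expand : ∀ e l c d → e * (l * (+ 1 - c * d)) ≡ e * l - c * (d * (e * l))
    expand = solve-∀
    cancel : ∀ g z → g - z + z ≡ g
    cancel = solve-∀
    at-0ᵥ : c * (E 0ᵥ * L 0ᵥ) ≡ c * e
    at-0ᵥ = begin
      c * (E 0ᵥ * L 0ᵥ)              ≡⟨ cong₂ (λ a b → c * (a * (ζ^ b) (ι i))) (ζ⁻⟨_,0⟩ x q) f-0ᵥ ⟩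
      c * (e * (ζ^ 𝟘) (ι i))         ≡⟨ regroup c e _ ⟩
      c * (ζ^ 𝟘) (ι i) * e           ≡⟨ cong (_* e) (χ-isP-ζ^𝟘 i) ⟩
      c * e ∎
      where regroup : ∀ c e z → c * (e * z) ≡ c * z * e
            regroup = solve-∀

  u≗𝓕fᵢ+r : ∀ i → i ≤ℕ p → ∀ x → u (ι i) x ≗ 𝓕 (indic p f i) x +ᶜ r i · ζ^ 𝟘
  u≗𝓕fᵢ+r i i≤p x q = trans (cong (_+ M * (ζ^ 𝟘) q) (sym (𝓕fᵢ≗G i i≤p x q)))
                             (collect (𝓕 (indic p f i) x q) (χ (isP i)) M ((ζ^ 𝟘) q))
    where collect : ∀ h c m e → h + c * e + m * e ≡ h + (m + c) * e
          collect = solve-∀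

  u-idempotent : ∀ j x → x ≢ 0ᵥ → u j x ∗ u j x ≈ N · u j x
  u-idempotent j x x≢0 = subst (λ j → u j x ∗ u j x ≈ N · u j x) (ι-index j) (≈-trans (∗-cong u≈ u≈)
    (≈-trans (𝓕fᵢ+r-idempotent i 1≤i i≤p x x≢0) (·-cong N (≈-sym u≈))))
    where
    i = index j
    1≤i = proj₁ (index-range j)
    i≤p = proj₂ (index-range j)
    u≈ = ≗⇒≈ (u≗𝓕fᵢ+r i i≤p x)

  u-real : ∀ j x → σ (u j x) ≗ u j x
  u-real j x q = cong₂ _+_ G-real (cong (M *_) (trans (ζ^-⊖ 𝟘 q) (cong (λ a → (ζ^ a) q) ⊖-𝟘)))
    where
    open ≡-Reasoning
    G-real : G j x (⊖ q) ≡ G j x q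
    G-real = begin
      ∑V (λ y → ζ⁻⟨ x , y ⟩ (⊖ q) * (ζ^ (f y)) j)
        ≡⟨ ∑-cong (allPts p (2 *ℕ m)) (λ y → cong (_* (ζ^ (f y)) j)
             (trans (ζ^-⊖ (⊖ ⟨ x , y ⟩) q) (cong (λ a → (ζ^ a) q) (⊖-involutive ⟨ x , y ⟩)))) ⟩
      ∑V (λ y → (ζ^ ⟨ x , y ⟩) q * (ζ^ (f y)) j)
        ≡⟨ ∑V.∑-reindex -ᵥ_ -ᵥ_ -ᵥ-involutive -ᵥ-involutive (λ y → (ζ^ ⟨ x , y ⟩) q * (ζ^ (f y)) j) ⟨
      ∑V (λ y → (ζ^ ⟨ x , -ᵥ y ⟩) q * (ζ^ (f (-ᵥ y))) j)
        ≡⟨ ∑-cong (allPts p (2 *ℕ m)) (λ y → cong₂ (λ a b → (ζ^ a) q * (ζ^ b) j) (⟨⟩--ᵥʳ x y) (f-even y)) ⟩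
      ∑V (λ y → ζ⁻⟨ x , y ⟩ q * (ζ^ (f y)) j) ∎

  ∑G≗S : ∀ x → ∑ᶜ (allFin p) (λ j → G j x) ≗ S x
  ∑G≗S x q = trans (∑-comm (allFin p) (allPts p (2 *ℕ m)) (λ j y → ζ⁻⟨ x , y ⟩ q * (ζ^ (f y)) j))
    (∑-cong (allPts p (2 *ℕ m)) (λ y →
      trans (∑-cong (allFin p) (λ j → *-comm (ζ⁻⟨ x , y ⟩ q) _)) (∑F.∑-δ′ (f y) (λ _ → ζ⁻⟨ x , y ⟩ q))))

  ∑u≈N : ∀ x → x ≢ 0ᵥ → ∑ᶜ (allFin p) (λ j → u j x) ≈ N · ζ^ 𝟘
  ∑u≈N x x≢0 = ≈-trans (≗⇒≈ split) (≈0⇒+ᶜ≈ (N · ζ^ 𝟘) (S≈0 x x≢0))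
    where
    split : ∑ᶜ (allFin p) (λ j → u j x) ≗ N · ζ^ 𝟘 +ᶜ S x
    split q = trans (∑-distrib-+ (allFin p) (λ j → G j x q) (λ _ → M * (ζ^ 𝟘) q))
      (trans (cong₂ _+_ (∑G≗S x q) (trans (∑F-const _) (trans (sym (*-assoc (+ p) M _)) (cong (_* (ζ^ 𝟘) q) p·M≡N))))
             (+-comm (S x q) _))

  walsh≗ : ∀ x → walsh p f x ≗ (λ q → ∑V (λ y → (ζ^ (f y ⊝ ⟨ x , y ⟩)) q))
  walsh≗ x q = trans (csum≗∑ᶜ (allPts p (2 *ℕ m)) _ q)
                     (∑-cong (allPts p (2 *ℕ m)) (λ y → trans (mono≗· _ (+ 1) q) (*-identityˡ _)))

  -- Σ_j ζ^j G_j(x) is the Walsh transform, and Σ_j ζ^j = 0 kills the shift by N/p.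
  ∑ζʲu≈W : ∀ x → ∑ᶜ (allFin p) (λ j → ζ^ j ∗ u j x) ≈ walsh p f x
  ∑ζʲu≈W x = ≈-trans (≗⇒≈ split) (≈0⇒+ᶜ≈ (walsh p f x) (constant≈0 M))
    where
    open ≡-Reasoning
    twisted-G : ∀ q → ∑F (λ j → G j x (q ⊝ j)) ≡ walsh p f x q
    twisted-G q = begin
      ∑F (λ j → ∑V (λ y → ζ⁻⟨ x , y ⟩ (q ⊝ j) * (ζ^ (f y)) j))
        ≡⟨ ∑-comm (allFin p) (allPts p (2 *ℕ m)) _ ⟩
      ∑V (λ y → ∑F (λ j → ζ⁻⟨ x , y ⟩ (q ⊝ j) * (ζ^ (f y)) j))
        ≡⟨ ∑-cong (allPts p (2 *ℕ m)) (λ y → trans (∑-cong (allFin p) (λ j → *-comm (ζ⁻⟨ x , y ⟩ (q ⊝ j)) _))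
                                                   (∑F.∑-δ′ (f y) (λ j → ζ⁻⟨ x , y ⟩ (q ⊝ j)))) ⟩
      ∑V (λ y → ζ⁻⟨ x , y ⟩ (q ⊝ f y))
        ≡⟨ ∑-cong (allPts p (2 *ℕ m)) (λ y → trans (ζ^-⊝ _ (f y) q) (cong (λ a → (ζ^ a) q) (⊕-comm _ (f y)))) ⟩
      ∑V (λ y → (ζ^ (f y ⊝ ⟨ x , y ⟩)) q)
        ≡⟨ walsh≗ x q ⟨
      walsh p f x q ∎
    ∑ζ^ : ∀ q → ∑F (λ j → (ζ^ 𝟘) (q ⊝ j)) ≡ + 1
    ∑ζ^ q = trans (∑-cong (allFin p) (λ j → trans (ζ^-⊝ 𝟘 j q) (cong (λ a → (ζ^ a) q) (⊕-identityˡ j)))) (∑F-ζ^ q)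
    split : ∑ᶜ (allFin p) (λ j → ζ^ j ∗ u j x) ≗ walsh p f x +ᶜ (λ _ → M)
    split q = begin
      ∑F (λ j → (ζ^ j ∗ u j x) q)
        ≡⟨ ∑-cong (allFin p) (λ j → ζ^-∗ j (u j x) q) ⟩
      ∑F (λ j → G j x (q ⊝ j) + M * (ζ^ 𝟘) (q ⊝ j))                 ≡⟨ ∑-distrib-+ (allFin p) _ _ ⟩
      ∑F (λ j → G j x (q ⊝ j)) + ∑F (λ j → M * (ζ^ 𝟘) (q ⊝ j))
        ≡⟨ cong₂ _+_ (twisted-G q) (trans (∑-*ˡ (allFin p) M _) (trans (cong (M *_) (∑ζ^ q)) (*-identityʳ M))) ⟩
      walsh p f x q + M ∎

  G-0ᵥ≡∑ : ∀ j → G j 0ᵥ 𝟘 ≡ ∑V (λ y → (ζ^ (f y)) j)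
  G-0ᵥ≡∑ j = ∑-cong (allPts p (2 *ℕ m)) (λ y →
    trans (cong (_* (ζ^ (f y)) j) (trans (ζ⁻⟨0, y ⟩ 𝟘) (ζ^-diag 𝟘))) (*-identityˡ _))

  G-0ᵥ : ∀ j → G j 0ᵥ 𝟘 ≡ (N - + 1) * M + N * (ζ^ 𝟘) j
  G-0ᵥ j = subst (λ j → G j 0ᵥ 𝟘 ≡ (N - + 1) * M + N * (ζ^ 𝟘) j) (ι-index j) (begin
    G (ι i) 0ᵥ 𝟘                                ≡⟨ 𝓕fᵢ≗G i i≤p 0ᵥ 𝟘 ⟨
    𝓕 (indic p f i) 0ᵥ 𝟘 + χ (isP i) * (ζ^ 𝟘) 𝟘  ≡⟨ cong₂ (λ a b → a + χ (isP i) * b) 𝓕fᵢ-0ᵥ (ζ^-diag 𝟘) ⟩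
    k i + χ (isP i) * + 1                       ≡⟨ collect N M (χ (isP i)) ⟩
    (N - + 1) * M + N * χ (isP i)               ≡⟨ cong (λ b → (N - + 1) * M + N * χ b) isP≡ ⟩
    (N - + 1) * M + N * (ζ^ 𝟘) (ι i) ∎)
    where
    open ≡-Reasoning
    i = index j
    1≤i = proj₁ (index-range j)
    i≤p = proj₂ (index-range j)
    𝓕fᵢ-0ᵥ : 𝓕 (indic p f i) 0ᵥ 𝟘 ≡ k i
    𝓕fᵢ-0ᵥ = trans (∑-cong (allPts p (2 *ℕ m)) (λ y → trans (cong (_* indic p f i y) (trans (ζ⁻⟨0, y ⟩ 𝟘) (ζ^-diag 𝟘)))
                                                             (*-identityˡ _)))
                   (Γ.degree i 1≤i (srg i 1≤i i≤p))
    isP≡ : isP i ≡ feq p 𝟘 (ι i)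
    isP≡ = trans (index≡p j) (cong (feq p 𝟘) (sym (ι-index j)))
    collect : ∀ n m c → (n - + 1) * (m + c) + c * + 1 ≡ (n - + 1) * m + n * c
    collect = solve-∀

  walsh-0ᵥ : walsh p f 0ᵥ ≈ N · ζ^ 𝟘
  walsh-0ᵥ = ≈-trans (≗⇒≈ as-G) (≈0⇒+ᶜ≈ (N · ζ^ 𝟘) (constant≈0 ((N - + 1) * M)))
    where
    open ≡-Reasoning
    as-G : walsh p f 0ᵥ ≗ N · ζ^ 𝟘 +ᶜ (λ _ → (N - + 1) * M)
    as-G q = begin
      walsh p f 0ᵥ q                         ≡⟨ walsh≗ 0ᵥ q ⟩
      ∑V (λ y → (ζ^ (f y ⊝ ⟨ 0ᵥ , y ⟩)) q)
        ≡⟨ ∑-cong (allPts p (2 *ℕ m)) (λ y → cong (λ a → (ζ^ a) q) (trans (cong (f y ⊝_) (⟨⟩-0ᵥˡ y)) (⊝-𝟘 (f y)))) ⟩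
      ∑V (λ y → (ζ^ (f y)) q)                ≡⟨ G-0ᵥ≡∑ q ⟨
      G q 0ᵥ 𝟘                               ≡⟨ G-0ᵥ q ⟩
      (N - + 1) * M + N * (ζ^ 𝟘) q           ≡⟨ +-comm ((N - + 1) * M) (N * (ζ^ 𝟘) q) ⟩
      N * (ζ^ 𝟘) q + (N - + 1) * M ∎

module Dual (p : ℕ) {{_ : NonZero p}} (p-prime : Prime p) (m : ℕ) (m≥1 : 1 ≤ℕ m) (s : LSType)
  (f : Pt p (2 *ℕ m) → F p) (feasible : IsFeasible p m s f)
  (f* : Pt p (2 *ℕ m) → F p) (dual : IsDual p m s f f*) where

  open GF p
  open Vectors p
  open Cyclotomic p
  open CharacterSums p p-prime (2 *ℕ m)
  open Feasible p p-prime m m≥1 s f feasible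
  module LS* = LevelSets p (2 *ℕ m) f*

  walsh≈Nζ^f* : ∀ x → walsh p f x ≈ N · ζ^ (f* x)
  walsh≈Nζ^f* x = ≈-trans (Defs≈⇒≈ (dual x)) (≗⇒≈ (mono≗· (f* x) N))

  f*-0ᵥ : f* 0ᵥ ≡ 𝟘
  f*-0ᵥ = sym (ζ^-≈-injective (·-cancel N (≈-trans (≈-sym walsh-0ᵥ) (walsh≈Nζ^f* 0ᵥ))))

  u≈N·δ : ∀ x → x ≢ 0ᵥ → ∀ j → u j x ≈ (N * (ζ^ j) (f* x)) · ζ^ 𝟘
  u≈N·δ x x≢0 = OrthogonalIdempotents.w≈N·δ p p-prime N (λ j → u j x) (f* x)
    (λ j → u-idempotent j x x≢0) (λ j → ≗⇒≈ (u-real j x)) (∑u≈N x x≢0) (≈-trans (∑ζʲu≈W x) (walsh≈Nζ^f* x))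

  module _ (i : ℕ) (1≤i : 1 ≤ℕ i) (i≤p : i ≤ℕ p) where

    fᵢ f*ᵢ : V → ℤ
    fᵢ = indic p f i
    f*ᵢ = indic p f* i

    φ : V → ℤ
    φ y = N * r i * δ₀ y + N * f*ᵢ y + - r i

    𝓕fᵢ-0ᵥ≗φ : 𝓕 fᵢ 0ᵥ ≗ φ 0ᵥ · ζ^ 𝟘
    𝓕fᵢ-0ᵥ≗φ q = begin
      ∑V (λ y → ζ⁻⟨ 0ᵥ , y ⟩ q * fᵢ y)
        ≡⟨ ∑-cong (allPts p (2 *ℕ m)) (λ y → cong (_* fᵢ y) (ζ⁻⟨0, y ⟩ q)) ⟩
      ∑V (λ y → (ζ^ 𝟘) q * fᵢ y)
        ≡⟨ trans (∑-*ˡ (allPts p (2 *ℕ m)) ((ζ^ 𝟘) q) fᵢ) (cong ((ζ^ 𝟘) q *_) (Γ.degree i 1≤i (srg i 1≤i i≤p))) ⟩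
      (ζ^ 𝟘) q * k i
        ≡⟨ degree≡φ N (r i) ((ζ^ 𝟘) q) ⟩
      (N * r i * + 1 + N * + 0 + - r i) * (ζ^ 𝟘) q
        ≡⟨ cong₂ (λ d z → (N * r i * d + N * z + - r i) * (ζ^ 𝟘) q) (cong χ (⌊⌋-true (0ᵥ ≟ᵥ 0ᵥ) refl)) f*ᵢ-0ᵥ ⟨
      φ 0ᵥ * (ζ^ 𝟘) q ∎
      where
      open ≡-Reasoning
      f*ᵢ-0ᵥ : f*ᵢ 0ᵥ ≡ + 0
      f*ᵢ-0ᵥ = cong χ (LS*.inD-0ᵥ f*-0ᵥ i 1≤i)
      degree≡φ : ∀ n r e → e * ((n - + 1) * r) ≡ (n * r * + 1 + n * + 0 + - r) * e
      degree≡φ = solve-∀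

    𝓕fᵢ≈φ-≢0ᵥ : ∀ y → y ≢ 0ᵥ → 𝓕 fᵢ y ≈ φ y · ζ^ 𝟘
    𝓕fᵢ≈φ-≢0ᵥ y y≢0 = ≈-trans (≗⇒≈ (λ q → sym (shift-back q))) (≈-trans (+ᶜ-cong (u≈N·δ y y≢0 (ι i)) ≈-refl) (≗⇒≈ as-φ))
      where
      open ≡-Reasoning
      shift-back : ∀ q → u (ι i) y q + - r i * (ζ^ 𝟘) q ≡ 𝓕 fᵢ y q
      shift-back q = trans (cong (_+ - r i * (ζ^ 𝟘) q) (u≗𝓕fᵢ+r i i≤p y q)) (cancel (𝓕 fᵢ y q) (r i) ((ζ^ 𝟘) q))
        where cancel : ∀ h r e → h + r * e + - r * e ≡ h
              cancel = solve-∀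
      f*ᵢ-y : f*ᵢ y ≡ (ζ^ (ι i)) (f* y)
      f*ᵢ-y = trans (LS*.χ-inD-≢0ᵥ i i≤p y y≢0) (ζ^-sym (f* y) (ι i))
      as-φ : (N * (ζ^ (ι i)) (f* y)) · ζ^ 𝟘 +ᶜ (- r i) · ζ^ 𝟘 ≗ φ y · ζ^ 𝟘
      as-φ q = begin
        N * (ζ^ (ι i)) (f* y) * (ζ^ 𝟘) q + - r i * (ζ^ 𝟘) q
          ≡⟨ collect N _ (r i) ((ζ^ 𝟘) q) ⟩
        (N * r i * + 0 + N * (ζ^ (ι i)) (f* y) + - r i) * (ζ^ 𝟘) q
          ≡⟨ cong₂ (λ d g → (N * r i * d + N * g + - r i) * (ζ^ 𝟘) q) (cong χ (⌊⌋-false (y ≟ᵥ 0ᵥ) y≢0)) f*ᵢ-y ⟨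
        φ y * (ζ^ 𝟘) q ∎
        where collect : ∀ n a r e → n * a * e + - r * e ≡ (n * r * + 0 + n * a + - r) * e
              collect = solve-∀

    𝓕fᵢ≈φ : ∀ y → 𝓕 fᵢ y ≈ φ y · ζ^ 𝟘
    𝓕fᵢ≈φ y = by-cases (y ≟ᵥ 0ᵥ)
      where
      by-cases : Dec (y ≡ 0ᵥ) → 𝓕 fᵢ y ≈ φ y · ζ^ 𝟘
      by-cases (yes refl) = ≗⇒≈ 𝓕fᵢ-0ᵥ≗φ
      by-cases (no y≢0) = 𝓕fᵢ≈φ-≢0ᵥ y y≢0

    -- Transforming back: Σ_y f̂ᵢ(y) ζ^{⟨x,y⟩} = p^{2m} fᵢ(-x) = N² fᵢ(x), while by the values
    -- of f̂ᵢ it is N r + N f̂*ᵢ(x) - r S(x), and S(x) = N² δ₀(x).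
    𝓕f*ᵢ≈ : ∀ x → 𝓕 f*ᵢ x ≈ (N * fᵢ x + N * r i * δ₀ x - r i) · ζ^ 𝟘
    𝓕f*ᵢ≈ x = ·-cancel N (begin
      N · Y
        ≈⟨ ≗⇒≈ (λ q → regroup (N * r i) (Y q) (S x q) ((ζ^ 𝟘) q) N (r i)) ⟩
      B +ᶜ ((- (N * r i)) · ζ^ 𝟘 +ᶜ r i · S x)
        ≈⟨ +ᶜ-cong (≈-trans (≈-sym by-values) by-inversion)
                   (+ᶜ-cong (≈-refl {(- (N * r i)) · ζ^ 𝟘}) (·-cong (r i) S≈N²δ₀)) ⟩
      (N * N * fᵢ x) · ζ^ 𝟘 +ᶜ ((- (N * r i)) · ζ^ 𝟘 +ᶜ r i · ((N * N * δ₀ x) · ζ^ 𝟘))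
        ≈⟨ ≗⇒≈ (λ q → collect N (fᵢ x) (r i) (δ₀ x) ((ζ^ 𝟘) q)) ⟩
      N · ((N * fᵢ x + N * r i * δ₀ x - r i) · ζ^ 𝟘) ∎)
      where
      open ≈-Reasoning
      Y = 𝓕 f*ᵢ x
      B = (N * r i) · ζ^ 𝟘 +ᶜ N · Y +ᶜ (- r i) · S x
      by-values : 𝓕⁻ (𝓕 fᵢ) x ≈ B
      by-values = ≈-trans (𝓕⁻-cong x 𝓕fᵢ≈φ) (≗⇒≈ (λ q → trans (𝓕⁻-scalar φ x q) (𝓕-affine (N * r i) N (- r i) f*ᵢ x q)))
      by-inversion : 𝓕⁻ (𝓕 fᵢ) x ≈ (N * N * fᵢ x) · ζ^ 𝟘
      by-inversion = ≈-trans (𝓕⁻𝓕 fᵢ x)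
        (≗⇒≈ (λ q → cong (_* (ζ^ 𝟘) q) (cong₂ _*_ (sym N²≡p^2m) (cong χ (LevelSets.inD-neg p (2 *ℕ m) f f-even i x)))))
      S≈N²δ₀ : S x ≈ (N * N * δ₀ x) · ζ^ 𝟘
      S≈N²δ₀ = ≈-trans (S≈p^n·δ₀ x) (≗⇒≈ (λ q → cong (λ z → z * δ₀ x * (ζ^ 𝟘) q) (sym N²≡p^2m)))
      regroup : ∀ a y s e n r → n * y ≡ a * e + n * y + - r * s + (- a * e + r * s)
      regroup = solve-∀
      collect : ∀ n g r d e → n * n * g * e + (- (n * r) * e + r * (n * n * d * e)) ≡ n * ((n * g + n * r * d - r) * e)
      collect = solve-∀

proposition7p6 : (p : ℕ) .{{_ : NonZero p}} → Prime p → 2 <ℕ p →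
    (m : ℕ) → 1 ≤ℕ m → (s : LSType) →
    (f : Pt p (2 *ℕ m) → F p) → IsFeasible p m s f →
    (fs : Pt p (2 *ℕ m) → F p) → IsDual p m s f fs →
    (i : ℕ) → 1 ≤ℕ i → i ≤ℕ p → (x : Pt p (2 *ℕ m)) →
    Defs._≈_ p (fourier p (indic p fs i) x)
          (const p ((NN p m s * indic p f i x)
                    + (NN p m s * rr p m s i * (if veq p x (vzero p) then + 1 else + 0))
                    - rr p m s i))
proposition7p6 p p-prime _ m m≥1 s f feasible f* dual i 1≤i i≤p x =
  ≈⇒Defs≈ (≈-trans (≗⇒≈ (fourier≗𝓕 _ x)) (≈-trans (𝓕f*ᵢ≈ i 1≤i i≤p x) (≈-sym (≗⇒≈ (mono≗· 𝟘 _)))))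
  where
  open GF p {{prime⇒nonZero p-prime}}
  open Cyclotomic p {{prime⇒nonZero p-prime}}
  open CharacterSums p {{prime⇒nonZero p-prime}} p-prime (2 *ℕ m)
  open Dual p {{prime⇒nonZero p-prime}} p-prime m m≥1 s f feasible f* dual
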